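{- Let $r\ge 2$ be an integer and let $H$ be a $\{1,r\}$-graph on a finite vertex set $[n]$ (every edge of $H$ has cardinality $1$ or $r$). Suppose that the order of a maximum complete $\{1,r\}$-subgraph of $H$ equals $t$ and that the order of a maximum complete $\{1\}$-subgraph of $H$ also equals $t$, where $$t\geq \left\lceil \frac{[r(r-1)-1]^{r-2}}{[r(r-1)]^{r-3}}\right\rceil .$$ Then $$\lambda'(H)=\lambda'\left(K_t^{\{1,r\}}\right)=1+\frac{\prod_{i=1}^{r-1}(t-i)}{t^{r-1}}.$$
   Context: A hypergraph $H=(V,E)$ has edges that are subsets of $V$; its set of edge types is $R(H)=\{|F|:F\in E\}$, and $H$ is called an $R$-graph if $R(H)=R$. For $j\in R(H)$, $H^j$ (or $E^j$) denotes the set of edges of $H$ of cardinality $j$. The complete hypergraph $K_t^{R}$ has vertex set $[t]$ and edge set $\bigcup_{i\in R}\binom{[t]}{i}$. A complete $R$-subgraph of $H$ of order $t$ is a set $S$ of $t$ vertices such that every subset of $S$ whose cardinality lies in $R$ is an edge of $H$; in particular the order of a maximum complete $\{1\}$-subgraph is the number of $1$-edges of $H$. For $H$ with vertex set $[n]$ and $\vec x\in\mathbb{R}^n$, define $\lambda'(H,\vec x)=\sum_{j\in R(H)} j!\sum_{i_1i_2\ldots i_j\in H^j}x_{i_1}x_{i_2}\cdots x_{i_j}$, and the Lagrangian $\lambda'(H)=\max\{\lambda'(H,\vec x): \vec x\in S\}$, where $S=\{\vec x\in\mathbb{R}^n:\sum_{i=1}^n x_i=1,\ x_i\ge 0\}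$.
   Formalization: The vectors $\vec x$ in the simplex $S$ defining the Lagrangian have rational coordinates instead of real ones, for $H$ as well as for $K_t^{\{1,r\}}$. -}

module Defs where

open import Data.Nat as ℕ using (ℕ; zero; suc; _!; _∸_)
open import Data.Nat.Properties using (m^n≢0)
open import Data.Integer as ℤ using (ℤ; +_)
open import Data.Fin using (Fin; zero; suc)
open import Data.Fin.Subset using (Subset; ∣_∣; _⊆_; inside; outside)
open import Data.Vec using (Vec; []; _∷_)
open import Data.Bool using (Bool; true; false; if_then_else_; _∨_)
open import Data.List using (List; []; _∷_; _++_; map; foldr)
open import Data.Product using (Σ; _×_; _,_; ∃)
open import Data.Sum using (_⊎_)
open import Relation.Binary.PropositionalEquality using (_≡_)
open import Data.Rational as ℚ using (ℚ; 0ℚ; 1ℚ; _+_; _*_; _≤_; _/_)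

allSubsets : (n : ℕ) → List (Subset n)
allSubsets zero = [] ∷ []
allSubsets (suc n) = map (inside ∷_) (allSubsets n) ++ map (outside ∷_) (allSubsets n)

Hypergraph : ℕ → Set
Hypergraph n = Subset n → Bool

IsEdge : ∀ {n} → Hypergraph n → Subset n → Set
IsEdge E F = E F ≡ true

ℕtoℚ : ℕ → ℚ
ℕtoℚ k = (+ k) / 1

sumℚ : List ℚ → ℚ
sumℚ = foldr _+_ 0ℚ

sumFin : (n : ℕ) → (Fin n → ℚ) → ℚ
sumFin zero x = 0ℚ
sumFin (suc n) x = x zero + sumFin n (λ i → x (suc i))

prodSub : ∀ {n} → Subset n → (Fin n → ℚ) → ℚ
prodSub [] x = 1ℚ
prodSub (b ∷ F) x = (if b then x zero else 1ℚ) * prodSub F (λ i → x (suc i))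

lagrangianAt : ∀ {n} → Hypergraph n → (Fin n → ℚ) → ℚ
lagrangianAt {n} E x =
  sumℚ (map (λ F → if E F then ℕtoℚ (∣ F ∣ !) * prodSub F x else 0ℚ) (allSubsets n))

InSimplex : ∀ n → (Fin n → ℚ) → Set
InSimplex n x = (∀ i → 0ℚ ≤ x i) × sumFin n x ≡ 1ℚ

LagrangianIs : ∀ {n} → Hypergraph n → ℚ → Set
LagrangianIs {n} E v =
  ((x : Fin n → ℚ) → InSimplex n x → lagrangianAt E x ≤ v) ×
  (∃ λ (x : Fin n → ℚ) → InSimplex n x × lagrangianAt E x ≡ v)

IsCompleteSub : ∀ {n} → (ℕ → Set) → Hypergraph n → Subset n → Set
IsCompleteSub R E S = ∀ F → F ⊆ S → R ∣ F ∣ → IsEdge E F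

MaxCompleteOrder : ∀ {n} → (ℕ → Set) → Hypergraph n → ℕ → Set
MaxCompleteOrder R E t =
  (∃ λ S → ∣ S ∣ ≡ t × IsCompleteSub R E S) ×
  (∀ S → IsCompleteSub R E S → ∣ S ∣ ℕ.≤ t)

OneOr : ℕ → ℕ → Set
OneOr r k = k ≡ 1 ⊎ k ≡ r

One : ℕ → Set
One k = k ≡ 1

K1r : (t r : ℕ) → Hypergraph t
K1r t r F = (∣ F ∣ ℕ.≡ᵇ 1) ∨ (∣ F ∣ ℕ.≡ᵇ r)

prodDiff : ℕ → ℕ → ℤ
prodDiff t zero = ℤ.+ 1
prodDiff t (suc k) = prodDiff t k ℤ.* ((+ t) ℤ.- (+ suc k))

-- 1 + ∏_{i=1}^{r-1}(t-i) / t^{r-1}   (junk value 1 when t = 0)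
lagFormula : ℕ → ℕ → ℚ
lagFormula zero r = 1ℚ
lagFormula (suc s) r = 1ℚ + (prodDiff (suc s) (r ∸ 1) / (suc s ℕ.^ (r ∸ 1)))
  where instance _ = m^n≢0 (suc s) (r ∸ 1)

{-# OPTIONS --safe #-}
module Submission where

-- Let S be the t vertices carrying a 1-edge, a the weight x puts on S and b = 1 − a.
-- Every r-edge is an r-set, so λ'(H, x) ≤ a + r! e_r(x). Moving the vertices of S to
-- their mean weight u = a / t and melting the weight outside S into a mass b only
-- increases r! e_r, which gives r! e_r(x) ≤ Σ_j C(r,j) b^(r−j) t^(j) u^j, where t^(j) is
-- the falling factorial. The threshold on t makes t^(j) / t^j + j / r nondecreasing for
-- j ≤ r, so t^(j) / t^j ≤ c − j / r with c = 1 + t^(r) / t^r; summing, λ'(H, x) ≤ a + (c − a)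
-- = c. The uniform weight 1 / t on a complete {1, r}-subgraph of order t attains c.

open import Defs

module FallingFactorial where

  open import Data.Nat
  open import Data.Nat.Properties
  open import Data.Nat.Combinatorics.Base using (_P′_)
  open import Algebra.Properties.CommutativeSemigroup *-commutativeSemigroup using (x∙yz≈y∙xz; x∙yz≈y∙zx)
  open import Data.Nat.Tactic.RingSolver using (solve-∀)
  open import Data.Sum using (inj₁; inj₂)
  open import Relation.Binary.PropositionalEquality

  P′-vanish : ∀ {t j} → t < j → t P′ j ≡ 0
  P′-vanish {t} {suc j} t<1+j = cong (_* (t P′ j)) (m≤n⇒m∸n≡0 (m<1+n⇒m≤n t<1+j))

  P′-suc-+ : ∀ t i → t P′ suc i + i * (t P′ i) ≡ t * (t P′ i)
  P′-suc-+ t i with ≤-<-connex i t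
  ... | inj₁ i≤t = begin
    (t ∸ i) * (t P′ i) + i * (t P′ i) ≡⟨ *-distribʳ-+ (t P′ i) (t ∸ i) i ⟨
    (t ∸ i + i) * (t P′ i)            ≡⟨ cong (_* (t P′ i)) (m∸n+n≡m i≤t) ⟩
    t * (t P′ i)                      ∎
    where open ≡-Reasoning
  ... | inj₂ t<i rewrite P′-vanish t<i | *-zeroʳ i | *-zeroʳ t = trans (+-identityʳ _) (*-zeroʳ (t ∸ i))

  P′-suc : ∀ t j → suc t P′ suc j ≡ suc t * (t P′ j)
  P′-suc t zero = refl
  P′-suc t (suc j) = begin
    (t ∸ j) * (suc t P′ suc j)   ≡⟨ cong ((t ∸ j) *_) (P′-suc t j) ⟩
    (t ∸ j) * (suc t * (t P′ j)) ≡⟨ x∙yz≈y∙xz (t ∸ j) (suc t) (t P′ j) ⟩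
    suc t * (t P′ suc j)         ∎
    where open ≡-Reasoning

  P′-pascal : ∀ s j → s P′ suc j + suc j * (s P′ j) ≡ suc s P′ suc j
  P′-pascal s j = begin
    s P′ suc j + suc j * (s P′ j)         ≡⟨ x+[y+z]≡[x+z]+y (s P′ suc j) (s P′ j) (j * (s P′ j)) ⟩
    s P′ suc j + j * (s P′ j) + s P′ j    ≡⟨ cong (_+ s P′ j) (P′-suc-+ s j) ⟩
    s * (s P′ j) + s P′ j                 ≡⟨ +-comm (s * (s P′ j)) (s P′ j) ⟩
    suc s * (s P′ j)                      ≡⟨ P′-suc s j ⟨
    suc s P′ suc j                        ∎
    where
    open ≡-Reasoning
    x+[y+z]≡[x+z]+y : ∀ x y z → x + (y + z) ≡ x + z + y
    x+[y+z]≡[x+z]+y = solve-∀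

  P′≤^ : ∀ t j → t P′ j ≤ t ^ j
  P′≤^ t zero = ≤-refl
  P′≤^ t (suc j) = *-mono-≤ (m∸n≤m t j) (P′≤^ t j)

  P′≤*^ : ∀ t i → t P′ suc i ≤ t * (t ∸ 1) ^ i
  P′≤*^ t zero = ≤-refl
  P′≤*^ t (suc i) = begin
    (t ∸ suc i) * (t P′ suc i)       ≤⟨ *-mono-≤ (∸-monoʳ-≤ t (s≤s z≤n)) (P′≤*^ t i) ⟩
    (t ∸ 1) * (t * (t ∸ 1) ^ i)      ≡⟨ x∙yz≈y∙xz (t ∸ 1) t ((t ∸ 1) ^ i) ⟩
    t * (t ∸ 1) ^ suc i              ∎
    where open ≤-Reasoning

  bernoulli : ∀ a m → suc a ^ suc m ≤ a ^ m * suc a + m * suc a ^ m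
  bernoulli a zero =
    ≤-reflexive (trans (*-identityʳ (suc a)) (sym (trans (+-identityʳ (1 * suc a)) (*-identityˡ (suc a)))))
  bernoulli a (suc m) = begin
    suc a * suc a ^ suc m
      ≤⟨ *-monoʳ-≤ (suc a) (bernoulli a m) ⟩
    suc a * (a ^ m * suc a + m * suc a ^ m)
      ≡⟨ expand a (a ^ m) (suc a ^ m) m ⟩
    a ^ suc m * suc a + a ^ m * suc a + m * suc a ^ suc m
      ≤⟨ +-monoˡ-≤ (m * suc a ^ suc m) (+-monoʳ-≤ (a ^ suc m * suc a) a^m≤[1+a]^m) ⟩
    a ^ suc m * suc a + suc a ^ m * suc a + m * suc a ^ suc m
      ≡⟨ collect a (a ^ m) (suc a ^ m) m ⟩
    a ^ suc m * suc a + suc m * suc a ^ suc m ∎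
    where
    open ≤-Reasoning
    expand : ∀ a p q m → suc a * (p * suc a + m * q) ≡ a * p * suc a + p * suc a + m * (suc a * q)
    expand = solve-∀
    collect : ∀ a p q m → a * p * suc a + q * suc a + m * (suc a * q) ≡ a * p * suc a + suc m * (suc a * q)
    collect = solve-∀
    a^m≤[1+a]^m : a ^ m * suc a ≤ suc a ^ m * suc a
    a^m≤[1+a]^m = *-monoˡ-≤ (suc a) (^-monoˡ-≤ m (n≤1+n a))

  *-^-distrib : ∀ a b m → (a * b) ^ m ≡ a ^ m * b ^ m
  *-^-distrib a b zero = refl
  *-^-distrib a b (suc m) = trans (cong (a * b *_) (*-^-distrib a b m)) (interchange a b (a ^ m) (b ^ m))
    where
    interchange : ∀ a b c d → a * b * (c * d) ≡ a * c * (b * d)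
    interchange = solve-∀

  -- The hypothesis t ≥ [r(r−1) − 1]^(r−2) / [r(r−1)]^(r−3) of the theorem, cleared of denominators.
  Threshold : ℕ → ℕ → Set
  Threshold r t = (r * (r ∸ 1) ∸ 1) ^ (r ∸ 2) * (r * (r ∸ 1)) ≤ t * (r * (r ∸ 1)) ^ (r ∸ 2)

  module AboveThreshold (m t : ℕ) (threshold : Threshold (suc (suc m)) t) where

    r R : ℕ
    r = suc (suc m)
    R = r * suc m

    instance
      R^m≢0 : NonZero (R ^ m)
      R^m≢0 = m^n≢0 R m

    R≤t+m : R ≤ t + m
    R≤t+m = *-cancelʳ-≤ R (t + m) (R ^ m) (begin
      R * R ^ m                    ≤⟨ bernoulli (R ∸ 1) m ⟩
      (R ∸ 1) ^ m * R + m * R ^ m  ≤⟨ +-monoˡ-≤ (m * R ^ m) threshold ⟩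
      t * R ^ m + m * R ^ m        ≡⟨ *-distribʳ-+ (R ^ m) t m ⟨
      (t + m) * R ^ m              ∎)
      where open ≤-Reasoning

    r*m+2≤t : r * m + 2 ≤ t
    r*m+2≤t = +-cancelʳ-≤ m (r * m + 2) t (subst (_≤ t + m) (R≡r*m+2+m m) R≤t+m)
      where
      R≡r*m+2+m : ∀ m → (2 + m) * (1 + m) ≡ (2 + m) * m + 2 + m
      R≡r*m+2+m = solve-∀

    r≤t : r ≤ t
    r≤t = ≤-trans (+-monoʳ-≤ 2 (m≤n*m m r)) (subst (_≤ t) (+-comm (r * m) 2) r*m+2≤t)

    instance
      t≢0 : NonZero t
      t≢0 = >-nonZero (≤-trans (s≤s z≤n) r≤t)

    R*[t∸1]^m≤t^[1+m] : R * (t ∸ 1) ^ m ≤ t ^ suc m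
    R*[t∸1]^m≤t^[1+m] with ≤-<-connex R t
    ... | inj₁ R≤t = *-mono-≤ R≤t (^-monoˡ-≤ m (m∸n≤m t 1))
    ... | inj₂ t<R = *-cancelʳ-≤ (R * (t ∸ 1) ^ m) (t ^ suc m) (R ^ m) (begin
      R * (t ∸ 1) ^ m * R ^ m        ≡⟨ *-assoc R ((t ∸ 1) ^ m) (R ^ m) ⟩
      R * ((t ∸ 1) ^ m * R ^ m)      ≡⟨ cong (R *_) (*-^-distrib (t ∸ 1) R m) ⟨
      R * ((t ∸ 1) * R) ^ m          ≤⟨ *-monoʳ-≤ R (^-monoˡ-≤ m [t∸1]*R≤t*[R∸1]) ⟩
      R * (t * (R ∸ 1)) ^ m          ≡⟨ cong (R *_) (*-^-distrib t (R ∸ 1) m) ⟩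
      R * (t ^ m * (R ∸ 1) ^ m)      ≡⟨ x∙yz≈y∙zx R (t ^ m) ((R ∸ 1) ^ m) ⟩
      t ^ m * ((R ∸ 1) ^ m * R)      ≤⟨ *-monoʳ-≤ (t ^ m) threshold ⟩
      t ^ m * (t * R ^ m)            ≡⟨ *-assoc (t ^ m) t (R ^ m) ⟨
      t ^ m * t * R ^ m              ≡⟨ cong (_* R ^ m) (*-comm (t ^ m) t) ⟩
      t ^ suc m * R ^ m              ∎)
      where
      open ≤-Reasoning
      [t∸1]*R≤t*[R∸1] : (t ∸ 1) * R ≤ t * (R ∸ 1)
      [t∸1]*R≤t*[R∸1] = begin
        (t ∸ 1) * R    ≡⟨ *-distribʳ-∸ R t 1 ⟩
        t * R ∸ 1 * R  ≡⟨ cong (t * R ∸_) (*-identityˡ R) ⟩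
        t * R ∸ R      ≤⟨ ∸-monoʳ-≤ (t * R) (<⇒≤ t<R) ⟩
        t * R ∸ t      ≡⟨ cong (t * R ∸_) (*-identityʳ t) ⟨
        t * R ∸ t * 1  ≡⟨ *-distribˡ-∸ t R 1 ⟨
        t * (R ∸ 1)    ∎

    r*j*P′≤^ : ∀ j → j < r → r * j * (t P′ j) ≤ t ^ suc j
    r*j*P′≤^ j j<r with m<1+n⇒m<n∨m≡n j<r
    ... | inj₁ j<1+m = *-mono-≤ r*j≤t (P′≤^ t j)
      where
      r*j≤t : r * j ≤ t
      r*j≤t = ≤-trans (*-monoʳ-≤ r (m<1+n⇒m≤n j<1+m)) (≤-trans (m≤m+n (r * m) 2) r*m+2≤t)
    ... | inj₂ refl = begin
      R * (t P′ suc m)          ≤⟨ *-monoʳ-≤ R (P′≤*^ t m) ⟩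
      R * (t * (t ∸ 1) ^ m)     ≡⟨ x∙yz≈y∙xz R t ((t ∸ 1) ^ m) ⟩
      t * (R * (t ∸ 1) ^ m)     ≤⟨ *-monoʳ-≤ t R*[t∸1]^m≤t^[1+m] ⟩
      t * t ^ suc m             ∎
      where open ≤-Reasoning

    -- φ j / t ^ j = r (t P′ j) / t ^ j + j; the threshold makes it nondecreasing on j ≤ r.
    φ : ℕ → ℕ
    φ j = r * (t P′ j) + j * t ^ j

    t*φ≤φ-suc : ∀ j → j < r → t * φ j ≤ φ (suc j)
    t*φ≤φ-suc j j<r = begin
      t * (r * F + j * t ^ j)                     ≡⟨ distribute t r F j (t ^ j) ⟩
      r * (t * F) + j * t ^ suc j                 ≡⟨ cong (λ x → r * x + j * t ^ suc j) (P′-suc-+ t j) ⟨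
      r * (F′ + j * F) + j * t ^ suc j            ≡⟨ regroup r F′ j F (j * t ^ suc j) ⟩
      r * F′ + r * j * F + j * t ^ suc j          ≤⟨ +-monoˡ-≤ (j * t ^ suc j) (+-monoʳ-≤ (r * F′) (r*j*P′≤^ j j<r)) ⟩
      r * F′ + t ^ suc j + j * t ^ suc j          ≡⟨ +-assoc (r * F′) (t ^ suc j) (j * t ^ suc j) ⟩
      φ (suc j)                                   ∎
      where
      open ≤-Reasoning
      F = t P′ j
      F′ = t P′ suc j
      distribute : ∀ t r F j p → t * (r * F + j * p) ≡ r * (t * F) + j * (t * p)
      distribute = solve-∀
      regroup : ∀ r a j F c → r * (a + j * F) + c ≡ r * a + r * j * F + c
      regroup = solve-∀

    φ-ratio : ∀ j → j ≤ r → φ j * t ^ r ≤ t ^ j * φ r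
    φ-ratio j j≤r = go (r ∸ j) j (m+[n∸m]≡n j≤r)
      where
      go : ∀ d j → j + d ≡ r → φ j * t ^ r ≤ t ^ j * φ r
      go zero j j+0≡r rewrite trans (sym (+-identityʳ j)) j+0≡r = ≤-reflexive (*-comm (φ r) (t ^ r))
      go (suc d) j j+1+d≡r = *-cancelˡ-≤ t (begin
        t * (φ j * t ^ r)    ≡⟨ *-assoc t (φ j) (t ^ r) ⟨
        t * φ j * t ^ r      ≤⟨ *-monoˡ-≤ (t ^ r) (t*φ≤φ-suc j j<r) ⟩
        φ (suc j) * t ^ r    ≤⟨ go d (suc j) (trans (sym (+-suc j d)) j+1+d≡r) ⟩
        t ^ suc j * φ r      ≡⟨ *-assoc t (t ^ j) (φ r) ⟩
        t * (t ^ j * φ r)    ∎)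
        where
        open ≤-Reasoning
        j<r : j < r
        j<r = subst (j <_) j+1+d≡r (m<m+n j (s≤s z≤n))

module Lagrangian where

  open FallingFactorial
  open import Algebra.Bundles using (CommutativeRing)
  open import Data.Bool using (true; false; if_then_else_; _∧_; _∨_)
  open import Data.Bool.Properties using (T-≡; ∧-identityʳ; ∨-zeroʳ)
  open import Data.Fin using (Fin; zero; suc)
  open import Data.Fin.Subset using (Subset; ∣_∣; _⊆_; _∈_; inside; outside; ⊥; ⊤; ⁅_⁆; ∁)
  open import Data.Fin.Subset.Properties
    using (∣⊤∣≡n; ∣p∣≤n; drop-∷-⊆; s⊆s; out⊆; ∣⁅x⁆∣≡1; x∈⁅y⁆⇒x≡y; p⊆q⇒∣p∣≤∣q∣)
  import Data.Integer as ℤ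
  import Data.Integer.Properties as ℤ
  open import Data.List using (List; []; _∷_; _++_; map)
  import Data.List.Properties
  import Data.Nat as ℕ
  open ℕ using (ℕ; zero; suc; _!; z≤n; s≤s)
  import Data.Nat.Properties as ℕ
  open import Data.Nat.Combinatorics.Base using (_P′_)
  import Data.Nat.Coprimality as Coprime
  open import Data.Product using (_×_; _,_; ∃)
  open import Data.Rational using (ℚ; _/_; toℚᵘ; 0ℚ; 1ℚ; _+_; _*_; _-_; -_; _≤_; 1/_; NonZero; Positive; nonNegative)
  open import Data.Rational.Properties
  open import Data.Rational.Solver using (module +-*-Solver)
  import Data.Rational.Unnormalised as ℚᵘ
  open ℚᵘ using (mkℚᵘ)
  import Data.Rational.Unnormalised.Properties as ℚᵘ
  open import Data.Sum using (_⊎_; inj₁; inj₂)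
  open import Data.Vec using ([]; _∷_; here; tabulate; lookup)
  open import Data.Vec.Functional using (tail)
  open import Data.Vec.Properties using ([]=⇒lookup; lookup⇒[]=; lookup∘tabulate)
  open import Function using (_∘_)
  open import Function.Bundles using (Equivalence)
  open import Relation.Binary.PropositionalEquality hiding (J)

  open +-*-Solver
  open CommutativeRing +-*-commutativeRing using (commutativeSemiring; semiring)
  open import Algebra.Properties.CommutativeSemiring.Exp commutativeSemiring using (_^_; ^-distrib-*)
  import Algebra.Properties.Semiring.Mult semiring as Mult

  ℕtoℚ-suc : ∀ k → ℕtoℚ (suc k) ≡ 1ℚ + ℕtoℚ k
  ℕtoℚ-suc k = trans (/-cong (cong (ℤ._+_ (ℤ.+ 1)) (sym (ℤ.*-identityʳ (ℤ.+ k)))) refl)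
                     (cong (1ℚ +_) (sym (normalize-coprime (Coprime.sym (Coprime.1-coprimeTo k)))))

  ℕtoℚ≡×1 : ∀ k → ℕtoℚ k ≡ k Mult.× 1ℚ
  ℕtoℚ≡×1 zero = refl
  ℕtoℚ≡×1 (suc k) = trans (ℕtoℚ-suc k) (cong (1ℚ +_) (ℕtoℚ≡×1 k))

  ℕtoℚ-+ : ∀ m n → ℕtoℚ (m ℕ.+ n) ≡ ℕtoℚ m + ℕtoℚ n
  ℕtoℚ-+ m n rewrite ℕtoℚ≡×1 m | ℕtoℚ≡×1 n | ℕtoℚ≡×1 (m ℕ.+ n) = Mult.×-homo-+ 1ℚ m n

  ℕtoℚ-* : ∀ m n → ℕtoℚ (m ℕ.* n) ≡ ℕtoℚ m * ℕtoℚ n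
  ℕtoℚ-* m n rewrite ℕtoℚ≡×1 m | ℕtoℚ≡×1 n | ℕtoℚ≡×1 (m ℕ.* n) = Mult.×1-homo-* m n

  ℕtoℚ-^ : ∀ t k → ℕtoℚ (t ℕ.^ k) ≡ ℕtoℚ t ^ k
  ℕtoℚ-^ t zero = refl
  ℕtoℚ-^ t (suc k) = trans (ℕtoℚ-* t (t ℕ.^ k)) (cong (ℕtoℚ t *_) (ℕtoℚ-^ t k))

  ℕtoℚ-nonNeg : ∀ k → 0ℚ ≤ ℕtoℚ k
  ℕtoℚ-nonNeg k = nonNegative⁻¹ (ℕtoℚ k) {{normalize-nonNeg k 1}}

  ℕtoℚ-pos : ∀ k → .{{ℕ.NonZero k}} → Positive (ℕtoℚ k)
  ℕtoℚ-pos (suc k) = normalize-pos (suc k) 1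

  ℕtoℚ-nonZero : ∀ k → .{{ℕ.NonZero k}} → NonZero (ℕtoℚ k)
  ℕtoℚ-nonZero k = pos⇒nonZero (ℕtoℚ k) {{ℕtoℚ-pos k}}

  1/ℕtoℚ-nonNeg : ∀ k → .{{_ : ℕ.NonZero k}} → 0ℚ ≤ (1/ ℕtoℚ k) {{ℕtoℚ-nonZero k}}
  1/ℕtoℚ-nonNeg k = nonNegative⁻¹ k⁻¹ {{pos⇒nonNeg k⁻¹ {{1/pos⇒pos (ℕtoℚ k) {{ℕtoℚ-pos k}}}}}}
    where k⁻¹ = (1/ ℕtoℚ k) {{ℕtoℚ-nonZero k}}

  ≤-by-gap : ∀ {p q} d → 0ℚ ≤ d → q ≡ p + d → p ≤ q
  ≤-by-gap {p} d 0≤d refl = subst (_≤ p + d) (+-identityʳ p) (+-monoʳ-≤ p 0≤d)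

  ℕtoℚ-mono-≤ : ∀ {m n} → m ℕ.≤ n → ℕtoℚ m ≤ ℕtoℚ n
  ℕtoℚ-mono-≤ {m} m≤n with ℕ.m≤n⇒∃[o]m+o≡n m≤n
  ... | d , refl = ≤-by-gap (ℕtoℚ d) (ℕtoℚ-nonNeg d) (ℕtoℚ-+ m d)

  nonNeg-+ : ∀ {p q} → 0ℚ ≤ p → 0ℚ ≤ q → 0ℚ ≤ p + q
  nonNeg-+ = +-mono-≤

  nonNeg-* : ∀ {p q} → 0ℚ ≤ p → 0ℚ ≤ q → 0ℚ ≤ p * q
  nonNeg-* {p} {q} 0≤p 0≤q =
    nonNegative⁻¹ (p * q) {{nonNeg*nonNeg⇒nonNeg p {{nonNegative 0≤p}} q {{nonNegative 0≤q}}}}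

  nonNeg-^ : ∀ {p} n → 0ℚ ≤ p → 0ℚ ≤ p ^ n
  nonNeg-^ zero 0≤p = nonNegative⁻¹ 1ℚ
  nonNeg-^ (suc n) 0≤p = nonNeg-* 0≤p (nonNeg-^ n 0≤p)

  nonNeg-square : ∀ p → 0ℚ ≤ p * p
  nonNeg-square p with ≤-total 0ℚ p
  ... | inj₁ 0≤p = nonNeg-* 0≤p 0≤p
  ... | inj₂ p≤0 = subst (0ℚ ≤_) (neg*neg p) (nonNeg-* 0≤-p 0≤-p)
    where
    0≤-p = neg-antimono-≤ p≤0
    neg*neg : ∀ p → - p * - p ≡ p * p
    neg*neg = solve 1 (λ p → (:- p) :* (:- p) := p :* p) refl

  *-monoˡ-≤-0≤ : ∀ {c p q} → 0ℚ ≤ c → p ≤ q → c * p ≤ c * q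
  *-monoˡ-≤-0≤ {c} 0≤c = *-monoˡ-≤-nonNeg c {{nonNegative 0≤c}}

  *-monoʳ-≤-0≤ : ∀ {c p q} → 0ℚ ≤ c → p ≤ q → p * c ≤ q * c
  *-monoʳ-≤-0≤ {c} 0≤c = *-monoʳ-≤-nonNeg c {{nonNegative 0≤c}}

  1^n≡1 : ∀ n → 1ℚ ^ n ≡ 1ℚ
  1^n≡1 zero = refl
  1^n≡1 (suc n) = trans (*-identityˡ (1ℚ ^ n)) (1^n≡1 n)

  sumℚ-++ : ∀ xs ys → sumℚ (xs ++ ys) ≡ sumℚ xs + sumℚ ys
  sumℚ-++ [] ys = sym (+-identityˡ (sumℚ ys))
  sumℚ-++ (x ∷ xs) ys = trans (cong (x +_) (sumℚ-++ xs ys)) (sym (+-assoc x (sumℚ xs) (sumℚ ys)))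

  module _ {A : Set} where

    sumℚ-map-mono : ∀ {f g : A → ℚ} → (∀ a → f a ≤ g a) → ∀ xs → sumℚ (map f xs) ≤ sumℚ (map g xs)
    sumℚ-map-mono f≤g [] = ≤-refl
    sumℚ-map-mono f≤g (x ∷ xs) = +-mono-≤ (f≤g x) (sumℚ-map-mono f≤g xs)

    sumℚ-map-cong : ∀ {f g : A → ℚ} → (∀ a → f a ≡ g a) → ∀ xs → sumℚ (map f xs) ≡ sumℚ (map g xs)
    sumℚ-map-cong f≗g xs = cong sumℚ (Data.List.Properties.map-cong f≗g xs)

    sumℚ-map-+ : ∀ (f g : A → ℚ) xs → sumℚ (map (λ a → f a + g a) xs) ≡ sumℚ (map f xs) + sumℚ (map g xs)
    sumℚ-map-+ f g [] = refl
    sumℚ-map-+ f g (x ∷ xs) = trans (cong (f x + g x +_) (sumℚ-map-+ f g xs))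
      (solve 4 (λ a b c d → (a :+ b) :+ (c :+ d) := (a :+ c) :+ (b :+ d)) refl (f x) (g x) (sumℚ (map f xs)) (sumℚ (map g xs)))

    sumℚ-map-* : ∀ c (f : A → ℚ) xs → sumℚ (map (λ a → c * f a) xs) ≡ c * sumℚ (map f xs)
    sumℚ-map-* c f [] = sym (*-zeroʳ c)
    sumℚ-map-* c f (x ∷ xs) = trans (cong (c * f x +_) (sumℚ-map-* c f xs)) (sym (*-distribˡ-+ c (f x) (sumℚ (map f xs))))

    sumℚ-map-0 : ∀ (xs : List A) → sumℚ (map (λ _ → 0ℚ) xs) ≡ 0ℚ
    sumℚ-map-0 [] = refl
    sumℚ-map-0 (x ∷ xs) = trans (+-identityˡ _) (sumℚ-map-0 xs)

  lagrangianWith : ∀ {n} → (ℕ → ℚ) → Hypergraph n → (Fin n → ℚ) → ℚ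
  lagrangianWith {n} v E x = sumℚ (map (λ F → if E F then v ∣ F ∣ * prodSub F x else 0ℚ) (allSubsets n))

  factorial : ℕ → ℚ
  factorial k = ℕtoℚ (k !)

  lagrangianWith-∷ : ∀ {n} v (E : Hypergraph (suc n)) x →
    lagrangianWith v E x ≡
    x zero * lagrangianWith (v ∘ suc) (E ∘ (inside ∷_)) (tail x) + lagrangianWith v (E ∘ (outside ∷_)) (tail x)
  lagrangianWith-∷ {n} v E x = begin
    sumℚ (map term (map (inside ∷_) Fs ++ map (outside ∷_) Fs))
      ≡⟨ cong sumℚ (Data.List.Properties.map-++ term (map (inside ∷_) Fs) (map (outside ∷_) Fs)) ⟩
    sumℚ (map term (map (inside ∷_) Fs) ++ map term (map (outside ∷_) Fs))
      ≡⟨ sumℚ-++ (map term (map (inside ∷_) Fs)) (map term (map (outside ∷_) Fs)) ⟩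
    sumℚ (map term (map (inside ∷_) Fs)) + sumℚ (map term (map (outside ∷_) Fs))
      ≡⟨ cong₂ (λ a b → sumℚ a + sumℚ b) (sym (Data.List.Properties.map-∘ Fs)) (sym (Data.List.Properties.map-∘ Fs)) ⟩
    sumℚ (map (term ∘ (inside ∷_)) Fs) + sumℚ (map (term ∘ (outside ∷_)) Fs)
      ≡⟨ cong₂ _+_ (trans (sumℚ-map-cong inside-term Fs) (sumℚ-map-* (x zero) _ Fs)) (sumℚ-map-cong outside-term Fs) ⟩
    x zero * lagrangianWith (v ∘ suc) (E ∘ (inside ∷_)) (tail x) + lagrangianWith v (E ∘ (outside ∷_)) (tail x) ∎
    where
    open ≡-Reasoning
    Fs = allSubsets n
    term = λ F → if E F then v ∣ F ∣ * prodSub F x else 0ℚ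
    inside-term : ∀ F → term (inside ∷ F) ≡ x zero * (if E (inside ∷ F) then v (suc ∣ F ∣) * prodSub F (tail x) else 0ℚ)
    inside-term F with E (inside ∷ F)
    ... | true = solve 3 (λ a b c → a :* (b :* c) := b :* (a :* c)) refl (v (suc ∣ F ∣)) (x zero) (prodSub F (tail x))
    ... | false = sym (*-zeroʳ (x zero))
    outside-term : ∀ F → term (outside ∷ F) ≡ (if E (outside ∷ F) then v ∣ F ∣ * prodSub F (tail x) else 0ℚ)
    outside-term F with E (outside ∷ F)
    ... | true = cong (v ∣ F ∣ *_) (*-identityˡ (prodSub F (tail x)))
    ... | false = refl

  lagrangianWith-cong : ∀ {n} v {E E′ : Hypergraph n} → (∀ F → E F ≡ E′ F) → ∀ x →
    lagrangianWith v E x ≡ lagrangianWith v E′ x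
  lagrangianWith-cong {n} v E≗E′ x =
    sumℚ-map-cong (λ F → cong (λ b → if b then v ∣ F ∣ * prodSub F x else 0ℚ) (E≗E′ F)) (allSubsets n)

  prodSub-nonNeg : ∀ {n} (F : Subset n) x → (∀ i → 0ℚ ≤ x i) → 0ℚ ≤ prodSub F x
  prodSub-nonNeg [] x 0≤x = nonNegative⁻¹ 1ℚ
  prodSub-nonNeg (inside ∷ F) x 0≤x = nonNeg-* (0≤x zero) (prodSub-nonNeg F (tail x) (0≤x ∘ suc))
  prodSub-nonNeg (outside ∷ F) x 0≤x = nonNeg-* (nonNegative⁻¹ 1ℚ) (prodSub-nonNeg F (tail x) (0≤x ∘ suc))

  lagrangianWith-mono : ∀ {n} v {E E′ : Hypergraph n} x → (∀ k → 0ℚ ≤ v k) → (∀ i → 0ℚ ≤ x i) →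
    (∀ F → IsEdge E F → IsEdge E′ F) → lagrangianWith v E x ≤ lagrangianWith v E′ x
  lagrangianWith-mono {n} v {E} {E′} x 0≤v 0≤x E⊆E′ = sumℚ-map-mono term-mono (allSubsets n)
    where
    term-mono : ∀ F → (if E F then v ∣ F ∣ * prodSub F x else 0ℚ) ≤ (if E′ F then v ∣ F ∣ * prodSub F x else 0ℚ)
    term-mono F with E F in F∈E | E′ F in F∈E′
    ... | false | false = ≤-refl
    ... | false | true = nonNeg-* (0≤v ∣ F ∣) (prodSub-nonNeg F x 0≤x)
    ... | true | true = ≤-refl
    ... | true | false with () ← trans (sym (E⊆E′ F F∈E)) F∈E′

  lagrangianWith-∨ : ∀ {n} v (E₁ E₂ : Hypergraph n) x → (∀ F → IsEdge E₁ F → E₂ F ≡ false) →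
    lagrangianWith v (λ F → E₁ F ∨ E₂ F) x ≡ lagrangianWith v E₁ x + lagrangianWith v E₂ x
  lagrangianWith-∨ {n} v E₁ E₂ x disjoint =
    trans (sumℚ-map-cong term-∨ (allSubsets n)) (sumℚ-map-+ _ _ (allSubsets n))
    where
    term-∨ : ∀ F → (if E₁ F ∨ E₂ F then v ∣ F ∣ * prodSub F x else 0ℚ) ≡
                   (if E₁ F then v ∣ F ∣ * prodSub F x else 0ℚ) + (if E₂ F then v ∣ F ∣ * prodSub F x else 0ℚ)
    term-∨ F with E₁ F in F∈E₁ | E₂ F in F∈E₂
    ... | false | false = refl
    ... | false | true = sym (+-identityˡ _)
    ... | true | false = sym (+-identityʳ _)
    ... | true | true with () ← trans (sym (disjoint F F∈E₁)) F∈E₂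

  complete : ∀ {n} → ℕ → Hypergraph n
  complete k F = ∣ F ∣ ℕ.≡ᵇ k

  complete-size : ∀ {n k} (F : Subset n) → IsEdge (complete k) F → ∣ F ∣ ≡ k
  complete-size {k = k} F F∈K = ℕ.≡ᵇ⇒≡ ∣ F ∣ k (Equivalence.from T-≡ F∈K)

  complete-of-size : ∀ {n k} (F : Subset n) → ∣ F ∣ ≡ k → IsEdge (complete k) F
  complete-of-size {k = k} F ∣F∣≡k = Equivalence.to T-≡ (ℕ.≡⇒≡ᵇ ∣ F ∣ k ∣F∣≡k)

  lagrangianWith-size-0 : ∀ {n} v (G : Hypergraph n) x →
    lagrangianWith v (λ F → complete 0 F ∧ G F) x ≡ (if G ⊥ then v 0 else 0ℚ)
  lagrangianWith-size-0 {zero} v G x with G []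
  ... | true = trans (+-identityʳ (v 0 * 1ℚ)) (*-identityʳ (v 0))
  ... | false = refl
  lagrangianWith-size-0 {suc n} v G x = begin
    lagrangianWith v (λ F → complete 0 F ∧ G F) x
      ≡⟨ lagrangianWith-∷ v _ x ⟩
    x zero * lagrangianWith (v ∘ suc) (λ _ → false) (tail x) + lagrangianWith v (λ F → complete 0 F ∧ G (outside ∷ F)) (tail x)
      ≡⟨ cong₂ (λ a b → x zero * a + b) (sumℚ-map-0 (allSubsets n)) (lagrangianWith-size-0 v (G ∘ (outside ∷_)) (tail x)) ⟩
    x zero * 0ℚ + (if G ⊥ then v 0 else 0ℚ)
      ≡⟨ cong (_+ (if G ⊥ then v 0 else 0ℚ)) (*-zeroʳ (x zero)) ⟩
    0ℚ + (if G ⊥ then v 0 else 0ℚ)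
      ≡⟨ +-identityˡ _ ⟩
    (if G ⊥ then v 0 else 0ℚ) ∎
    where open ≡-Reasoning

  -- lagrangianWith (λ _ → 1ℚ) (complete k) is the elementary symmetric polynomial e_k.
  lagrangianWith-complete : ∀ {n} v k (x : Fin n → ℚ) →
    lagrangianWith v (complete k) x ≡ v k * lagrangianWith (λ _ → 1ℚ) (complete k) x
  lagrangianWith-complete {n} v k x = trans (sumℚ-map-cong term (allSubsets n)) (sumℚ-map-* (v k) _ (allSubsets n))
    where
    term : ∀ F → (if complete k F then v ∣ F ∣ * prodSub F x else 0ℚ) ≡
                 v k * (if complete k F then 1ℚ * prodSub F x else 0ℚ)
    term F with complete k F in F∈K
    ... | true = cong₂ _*_ (cong v (complete-size F F∈K)) (sym (*-identityˡ (prodSub F x)))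
    ... | false = sym (*-zeroʳ (v k))

  lagrangianAt-complete-0 : ∀ {n} (x : Fin n → ℚ) → lagrangianAt (complete 0) x ≡ 1ℚ
  lagrangianAt-complete-0 x =
    trans (lagrangianWith-cong factorial (λ F → sym (∧-identityʳ (complete 0 F))) x)
          (lagrangianWith-size-0 factorial (λ _ → true) x)

  lagrangianAt-complete-suc : ∀ {n} k (x : Fin (suc n) → ℚ) →
    lagrangianAt (complete (suc k)) x ≡
    lagrangianAt (complete (suc k)) (tail x) + ℕtoℚ (suc k) * x zero * lagrangianAt (complete k) (tail x)
  lagrangianAt-complete-suc k x = begin
    lagrangianAt (complete (suc k)) x
      ≡⟨ lagrangianWith-complete factorial (suc k) x ⟩
    ℕtoℚ (suc k !) * e (suc k) x
      ≡⟨ cong (ℕtoℚ (suc k !) *_) (lagrangianWith-∷ (λ _ → 1ℚ) (complete (suc k)) x) ⟩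
    ℕtoℚ (suc k !) * (x zero * e k (tail x) + e (suc k) (tail x))
      ≡⟨ cong (_* (x zero * e k (tail x) + e (suc k) (tail x))) (ℕtoℚ-* (suc k) (k !)) ⟩
    ℕtoℚ (suc k) * factorial k * (x zero * e k (tail x) + e (suc k) (tail x))
      ≡⟨ solve 5 (λ a b c d f → a :* b :* (c :* d :+ f) := a :* b :* f :+ a :* c :* (b :* d)) refl
           (ℕtoℚ (suc k)) (factorial k) (x zero) (e k (tail x)) (e (suc k) (tail x)) ⟩
    ℕtoℚ (suc k) * factorial k * e (suc k) (tail x) + ℕtoℚ (suc k) * x zero * (factorial k * e k (tail x))
      ≡⟨ cong₂ (λ a b → a * e (suc k) (tail x) + ℕtoℚ (suc k) * x zero * b)
           (sym (ℕtoℚ-* (suc k) (k !))) (sym (lagrangianWith-complete factorial k (tail x))) ⟩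
    ℕtoℚ (suc k !) * e (suc k) (tail x) + ℕtoℚ (suc k) * x zero * lagrangianAt (complete k) (tail x)
      ≡⟨ cong (_+ ℕtoℚ (suc k) * x zero * lagrangianAt (complete k) (tail x))
           (sym (lagrangianWith-complete factorial (suc k) (tail x))) ⟩
    lagrangianAt (complete (suc k)) (tail x) + ℕtoℚ (suc k) * x zero * lagrangianAt (complete k) (tail x) ∎
    where
    open ≡-Reasoning
    e : ∀ {n} → ℕ → (Fin n → ℚ) → ℚ
    e k = lagrangianWith (λ _ → 1ℚ) (complete k)

  -- binomialShift b k m = Σ_{j ≤ k} C(k,j) b^(k−j) m j is (b + X)^k with X^j read as m j,
  -- and ∂ is the matching derivative, (∂ m) j = j m (j − 1).
  binomialShift : ℚ → ℕ → (ℕ → ℚ) → ℚ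
  binomialShift b zero m = m 0
  binomialShift b (suc k) m = b * binomialShift b k m + binomialShift b k (m ∘ suc)

  ∂ : (ℕ → ℚ) → ℕ → ℚ
  ∂ m zero = 0ℚ
  ∂ m (suc j) = ℕtoℚ (suc j) * m j

  a*∂-^ : ∀ a j → a * ∂ (a ^_) j ≡ ℕtoℚ j * a ^ j
  a*∂-^ a zero = trans (*-zeroʳ a) (sym (*-zeroˡ 1ℚ))
  a*∂-^ a (suc i) = solve 3 (λ a J p → a :* (J :* p) := J :* (a :* p)) refl a (ℕtoℚ (suc i)) (a ^ i)

  module _ (b : ℚ) where

    binomialShift-mono : ∀ k {m m′} → 0ℚ ≤ b → (∀ j → j ℕ.≤ k → m j ≤ m′ j) →
      binomialShift b k m ≤ binomialShift b k m′
    binomialShift-mono zero 0≤b m≤m′ = m≤m′ 0 z≤n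
    binomialShift-mono (suc k) 0≤b m≤m′ =
      +-mono-≤ (*-monoˡ-≤-0≤ 0≤b (binomialShift-mono k 0≤b (λ j j≤k → m≤m′ j (ℕ.m≤n⇒m≤1+n j≤k))))
               (binomialShift-mono k 0≤b (λ j j≤k → m≤m′ (suc j) (s≤s j≤k)))

    binomialShift-nonNeg : ∀ k {m} → 0ℚ ≤ b → (∀ j → 0ℚ ≤ m j) → 0ℚ ≤ binomialShift b k m
    binomialShift-nonNeg zero 0≤b 0≤m = 0≤m 0
    binomialShift-nonNeg (suc k) 0≤b 0≤m =
      nonNeg-+ (nonNeg-* 0≤b (binomialShift-nonNeg k 0≤b 0≤m)) (binomialShift-nonNeg k 0≤b (0≤m ∘ suc))

    binomialShift-cong : ∀ k {m m′} → (∀ j → m j ≡ m′ j) → binomialShift b k m ≡ binomialShift b k m′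
    binomialShift-cong zero m≗m′ = m≗m′ 0
    binomialShift-cong (suc k) m≗m′ =
      cong₂ (λ u v → b * u + v) (binomialShift-cong k m≗m′) (binomialShift-cong k (m≗m′ ∘ suc))

    binomialShift-+ : ∀ k m m′ → binomialShift b k (λ j → m j + m′ j) ≡ binomialShift b k m + binomialShift b k m′
    binomialShift-+ zero m m′ = refl
    binomialShift-+ (suc k) m m′ =
      trans (cong₂ (λ u v → b * u + v) (binomialShift-+ k m m′) (binomialShift-+ k (m ∘ suc) (m′ ∘ suc)))
            (solve 5 (λ b u v w x → b :* (u :+ v) :+ (w :+ x) := (b :* u :+ w) :+ (b :* v :+ x)) refl
               b (binomialShift b k m) (binomialShift b k m′) (binomialShift b k (m ∘ suc)) (binomialShift b k (m′ ∘ suc)))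

    binomialShift-* : ∀ k c m → binomialShift b k (λ j → c * m j) ≡ c * binomialShift b k m
    binomialShift-* zero c m = refl
    binomialShift-* (suc k) c m =
      trans (cong₂ (λ u v → b * u + v) (binomialShift-* k c m) (binomialShift-* k c (m ∘ suc)))
            (solve 4 (λ b c u w → b :* (c :* u) :+ c :* w := c :* (b :* u :+ w)) refl
               b c (binomialShift b k m) (binomialShift b k (m ∘ suc)))

    binomialShift-∂ : ∀ k m → binomialShift b (suc k) (∂ m) ≡ ℕtoℚ (suc k) * binomialShift b k m
    binomialShift-∂ zero m = solve 2 (λ b x → b :* con 0ℚ :+ con 1ℚ :* x := con 1ℚ :* x) refl b (m 0)
    binomialShift-∂ (suc k) m = begin
      b * binomialShift b (suc k) (∂ m) + binomialShift b (suc k) (∂ m ∘ suc)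
        ≡⟨ cong₂ (λ u v → b * u + v) (binomialShift-∂ k m) (binomialShift-cong (suc k) ∂-suc) ⟩
      b * (K * B) + binomialShift b (suc k) (λ j → m j + ∂ (m ∘ suc) j)
        ≡⟨ cong (b * (K * B) +_) (binomialShift-+ (suc k) m (∂ (m ∘ suc))) ⟩
      b * (K * B) + (binomialShift b (suc k) m + binomialShift b (suc k) (∂ (m ∘ suc)))
        ≡⟨ cong (λ v → b * (K * B) + (binomialShift b (suc k) m + v)) (binomialShift-∂ k (m ∘ suc)) ⟩
      b * (K * B) + ((b * B + B′) + K * B′)
        ≡⟨ solve 4 (λ b K u w → b :* (K :* u) :+ ((b :* u :+ w) :+ K :* w) := (con 1ℚ :+ K) :* (b :* u :+ w)) refl b K B B′ ⟩
      (1ℚ + K) * binomialShift b (suc k) m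
        ≡⟨ cong (_* binomialShift b (suc k) m) (sym (ℕtoℚ-suc (suc k))) ⟩
      ℕtoℚ (suc (suc k)) * binomialShift b (suc k) m ∎
      where
      open ≡-Reasoning
      K = ℕtoℚ (suc k)
      B = binomialShift b k m
      B′ = binomialShift b k (m ∘ suc)
      ∂-suc : ∀ j → ∂ m (suc j) ≡ m j + ∂ (m ∘ suc) j
      ∂-suc zero = trans (*-identityˡ (m 0)) (sym (+-identityʳ (m 0)))
      ∂-suc (suc j) = trans (cong (_* m (suc j)) (ℕtoℚ-suc (suc j)))
        (solve 2 (λ J x → (con 1ℚ :+ J) :* x := x :+ J :* x) refl (ℕtoℚ (suc j)) (m (suc j)))

    binomialShift-^ : ∀ k a → binomialShift b k (a ^_) ≡ (a + b) ^ k
    binomialShift-^ zero a = refl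
    binomialShift-^ (suc k) a =
      trans (cong₂ (λ u v → b * u + v) (binomialShift-^ k a)
                   (trans (binomialShift-* k a (a ^_)) (cong (a *_) (binomialShift-^ k a))))
            (solve 3 (λ a b p → b :* p :+ a :* p := (a :+ b) :* p) refl a b ((a + b) ^ k))

    binomialShift-mean : ∀ k a → a + b ≡ 1ℚ → binomialShift b k (λ j → ℕtoℚ j * a ^ j) ≡ ℕtoℚ k * a
    binomialShift-mean zero a _ = trans (*-zeroˡ 1ℚ) (sym (*-zeroˡ a))
    binomialShift-mean (suc k) a a+b≡1 = begin
      binomialShift b (suc k) (λ j → ℕtoℚ j * a ^ j)  ≡⟨ binomialShift-cong (suc k) (λ j → sym (a*∂-^ a j)) ⟩
      binomialShift b (suc k) (λ j → a * ∂ (a ^_) j)  ≡⟨ binomialShift-* (suc k) a (∂ (a ^_)) ⟩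
      a * binomialShift b (suc k) (∂ (a ^_))          ≡⟨ cong (a *_) (binomialShift-∂ k (a ^_)) ⟩
      a * (ℕtoℚ (suc k) * binomialShift b k (a ^_))   ≡⟨ cong (λ p → a * (ℕtoℚ (suc k) * p)) (binomialShift-^ k a) ⟩
      a * (ℕtoℚ (suc k) * (a + b) ^ k)                ≡⟨ cong (λ p → a * (ℕtoℚ (suc k) * p ^ k)) a+b≡1 ⟩
      a * (ℕtoℚ (suc k) * 1ℚ ^ k)                     ≡⟨ cong (λ p → a * (ℕtoℚ (suc k) * p)) (1^n≡1 k) ⟩
      a * (ℕtoℚ (suc k) * 1ℚ)                         ≡⟨ solve 2 (λ a K → a :* (K :* con 1ℚ) := K :* a) refl a (ℕtoℚ (suc k)) ⟩
      ℕtoℚ (suc k) * a                                ∎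
      where open ≡-Reasoning

    binomialShift-+-∂ : ∀ k z m →
      binomialShift b (suc k) (λ j → m j + z * ∂ m j) ≡ binomialShift b (suc k) m + ℕtoℚ (suc k) * z * binomialShift b k m
    binomialShift-+-∂ k z m = begin
      binomialShift b (suc k) (λ j → m j + z * ∂ m j)
        ≡⟨ binomialShift-+ (suc k) m (λ j → z * ∂ m j) ⟩
      binomialShift b (suc k) m + binomialShift b (suc k) (λ j → z * ∂ m j)
        ≡⟨ cong (binomialShift b (suc k) m +_) (binomialShift-* (suc k) z (∂ m)) ⟩
      binomialShift b (suc k) m + z * binomialShift b (suc k) (∂ m)
        ≡⟨ cong (λ p → binomialShift b (suc k) m + z * p) (binomialShift-∂ k m) ⟩
      binomialShift b (suc k) m + z * (ℕtoℚ (suc k) * binomialShift b k m)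
        ≡⟨ cong (binomialShift b (suc k) m +_) (solve 3 (λ z K B → z :* (K :* B) := K :* z :* B) refl z (ℕtoℚ (suc k)) _) ⟩
      binomialShift b (suc k) m + ℕtoℚ (suc k) * z * binomialShift b k m ∎
      where open ≡-Reasoning

  binomialShift-absorb : ∀ b z k m → 0ℚ ≤ b → 0ℚ ≤ z → (∀ j → 0ℚ ≤ m j) →
    binomialShift b (suc k) m + ℕtoℚ (suc k) * z * binomialShift b k m ≤ binomialShift (z + b) (suc k) m
  binomialShift-absorb b z zero m 0≤b 0≤z 0≤m = ≤-by-gap 0ℚ ≤-refl
    (solve 4 (λ b z x y → (z :+ b) :* x :+ y := (b :* x :+ y :+ con 1ℚ :* z :* x) :+ con 0ℚ) refl b z (m 0) (m 1))
  binomialShift-absorb b z (suc k) m 0≤b 0≤z 0≤m = ≤-trans expand absorb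
    where
    K = ℕtoℚ (suc k)
    B₁ = binomialShift b k m
    B₂ = binomialShift b k (m ∘ suc)
    A₁ = binomialShift b (suc k) m
    A₂ = binomialShift b (suc k) (m ∘ suc)
    expand : binomialShift b (suc (suc k)) m + ℕtoℚ (suc (suc k)) * z * A₁ ≤
             (z + b) * (A₁ + K * z * B₁) + (A₂ + K * z * B₂)
    expand = ≤-by-gap (K * z * z * B₁)
      (nonNeg-* (nonNeg-* (nonNeg-* (ℕtoℚ-nonNeg (suc k)) 0≤z) 0≤z) (binomialShift-nonNeg b k 0≤b 0≤m))
      (trans (solve 6 (λ b z K B₁ B₂ A₂ → (z :+ b) :* ((b :* B₁ :+ B₂) :+ K :* z :* B₁) :+ (A₂ :+ K :* z :* B₂)
                  := (b :* (b :* B₁ :+ B₂) :+ A₂ :+ (con 1ℚ :+ K) :* z :* (b :* B₁ :+ B₂)) :+ K :* z :* z :* B₁) refl b z K B₁ B₂ A₂)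
             (cong (λ u → b * A₁ + A₂ + u * z * A₁ + K * z * z * B₁) (sym (ℕtoℚ-suc (suc k)))))
    absorb : (z + b) * (A₁ + K * z * B₁) + (A₂ + K * z * B₂) ≤ binomialShift (z + b) (suc (suc k)) m
    absorb = +-mono-≤ (*-monoˡ-≤-0≤ (nonNeg-+ 0≤z 0≤b) (binomialShift-absorb b z k m 0≤b 0≤z 0≤m))
                      (binomialShift-absorb b z k (m ∘ suc) 0≤b 0≤z (0≤m ∘ suc))

  weighted-am-gm : ∀ i {U V} → 0ℚ ≤ U → 0ℚ ≤ V → 0ℚ ≤ V ^ suc i + ℕtoℚ i * U ^ suc i - ℕtoℚ (suc i) * V * U ^ i
  weighted-am-gm zero {U} {V} _ _ = ≤-reflexive (sym (solve 2 (λ U V →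
    V :* con 1ℚ :+ con 0ℚ :* (U :* con 1ℚ) :- con 1ℚ :* V :* con 1ℚ := con 0ℚ) refl U V))
  weighted-am-gm (suc i) {U} {V} 0≤U 0≤V = subst (0ℚ ≤_) (sym gap-suc)
    (nonNeg-+ (nonNeg-* 0≤V (weighted-am-gm i 0≤U 0≤V))
              (nonNeg-* (nonNeg-* (ℕtoℚ-nonNeg (suc i)) (nonNeg-^ i 0≤U)) (nonNeg-square (V - U))))
    where
    I = ℕtoℚ i
    gap-suc : V ^ suc (suc i) + ℕtoℚ (suc i) * U ^ suc (suc i) - ℕtoℚ (suc (suc i)) * V * U ^ suc i ≡
              V * (V ^ suc i + I * U ^ suc i - ℕtoℚ (suc i) * V * U ^ i) + ℕtoℚ (suc i) * U ^ i * ((V - U) * (V - U))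
    gap-suc rewrite ℕtoℚ-suc (suc i) | ℕtoℚ-suc i = solve 5 (λ V U I P W →
      V :* (V :* W) :+ (con 1ℚ :+ I) :* (U :* (U :* P)) :- (con 1ℚ :+ (con 1ℚ :+ I)) :* V :* (U :* P)
      := V :* (V :* W :+ I :* (U :* P) :- (con 1ℚ :+ I) :* V :* P) :+ (con 1ℚ :+ I) :* P :* ((V :- U) :* (V :- U)))
      refl V U I (U ^ i) (V ^ i)

  -- λ'(K^(j)) at t vertices of weight u, see lagrangianAt-complete-indicator.
  fallingPow : ℕ → ℚ → ℕ → ℚ
  fallingPow t u j = ℕtoℚ (t P′ j) * u ^ j

  fallingPow-nonNeg : ∀ t {u} j → 0ℚ ≤ u → 0ℚ ≤ fallingPow t u j
  fallingPow-nonNeg t j 0≤u = nonNeg-* (ℕtoℚ-nonNeg (t P′ j)) (nonNeg-^ j 0≤u)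

  ℕtoℚ-P′-suc : ∀ t i → ℕtoℚ (t P′ suc i) ≡ (ℕtoℚ t - ℕtoℚ i) * ℕtoℚ (t P′ i)
  ℕtoℚ-P′-suc t i = begin
    G                            ≡⟨ solve 2 (λ G J → G := (G :+ J) :- J) refl G (ℕtoℚ i * F) ⟩
    G + ℕtoℚ i * F - ℕtoℚ i * F
      ≡⟨ cong (_- ℕtoℚ i * F) (trans (cong (G +_) (sym (ℕtoℚ-* i (t P′ i)))) (sym (ℕtoℚ-+ (t P′ suc i) _))) ⟩
    ℕtoℚ (t P′ suc i ℕ.+ i ℕ.* (t P′ i)) - ℕtoℚ i * F ≡⟨ cong (λ n → ℕtoℚ n - ℕtoℚ i * F) (P′-suc-+ t i) ⟩
    ℕtoℚ (t ℕ.* (t P′ i)) - ℕtoℚ i * F ≡⟨ cong (_- ℕtoℚ i * F) (ℕtoℚ-* t (t P′ i)) ⟩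
    ℕtoℚ t * F - ℕtoℚ i * F      ≡⟨ solve 3 (λ T I F → T :* F :- I :* F := (T :- I) :* F) refl (ℕtoℚ t) (ℕtoℚ i) F ⟩
    (ℕtoℚ t - ℕtoℚ i) * F        ∎
    where
    open ≡-Reasoning
    F = ℕtoℚ (t P′ i)
    G = ℕtoℚ (t P′ suc i)

  -- Giving a vertex of weight z and t vertices of weight u their mean weight u′ increases
  -- λ'(K^(j)) by (t + 1) (t P′ i) times an AM–GM gap.
  fallingPow-smooth : ∀ t {u u′} z j → 0ℚ ≤ u → 0ℚ ≤ u′ → ℕtoℚ (suc t) * u′ ≡ ℕtoℚ t * u + z →
    fallingPow t u j + z * ∂ (fallingPow t u) j ≤ fallingPow (suc t) u′ j
  fallingPow-smooth t z zero _ _ _ = ≤-reflexive (solve 1 (λ z → con 1ℚ :* con 1ℚ :+ z :* con 0ℚ := con 1ℚ :* con 1ℚ) refl z)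
  fallingPow-smooth t {u} {u′} z (suc i) 0≤u 0≤u′ mean = ≤-by-gap ((1ℚ + T) * F * gap) 0≤gain (begin
    ℕtoℚ (suc t P′ suc i) * u′ ^ suc i
      ≡⟨ cong (λ n → ℕtoℚ n * u′ ^ suc i) (P′-suc t i) ⟩
    ℕtoℚ (suc t ℕ.* (t P′ i)) * u′ ^ suc i
      ≡⟨ cong (_* u′ ^ suc i) (trans (ℕtoℚ-* (suc t) (t P′ i)) (cong (_* F) (ℕtoℚ-suc t))) ⟩
    (1ℚ + T) * F * u′ ^ suc i
      ≡⟨ expand ⟩
    fallingPow t u (suc i) + z * ∂ (fallingPow t u) (suc i) + (1ℚ + T) * F * gap ∎)
    where
    open ≡-Reasoning
    T = ℕtoℚ t
    F = ℕtoℚ (t P′ i)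
    gap = u′ ^ suc i + ℕtoℚ i * u ^ suc i - ℕtoℚ (suc i) * u′ * u ^ i
    0≤gain : 0ℚ ≤ (1ℚ + T) * F * gap
    0≤gain = nonNeg-* (nonNeg-* (nonNeg-+ (nonNegative⁻¹ 1ℚ) (ℕtoℚ-nonNeg t)) (ℕtoℚ-nonNeg (t P′ i)))
                      (weighted-am-gm i 0≤u 0≤u′)
    z≡ : z ≡ (1ℚ + T) * u′ - T * u
    z≡ = begin
      z                         ≡⟨ solve 2 (λ z a → z := (a :+ z) :- a) refl z (T * u) ⟩
      T * u + z - T * u         ≡⟨ cong (_- T * u) (sym mean) ⟩
      ℕtoℚ (suc t) * u′ - T * u ≡⟨ cong (λ a → a * u′ - T * u) (ℕtoℚ-suc t) ⟩
      (1ℚ + T) * u′ - T * u     ∎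
    expand : (1ℚ + T) * F * u′ ^ suc i ≡ fallingPow t u (suc i) + z * ∂ (fallingPow t u) (suc i) + (1ℚ + T) * F * gap
    expand = begin
      (1ℚ + T) * F * (u′ * W)
        ≡⟨ solve 7 (λ T I F U V P W →
             (con 1ℚ :+ T) :* F :* (V :* W)
             := (T :- I) :* F :* (U :* P) :+ ((con 1ℚ :+ T) :* V :- T :* U) :* ((con 1ℚ :+ I) :* (F :* P))
                :+ (con 1ℚ :+ T) :* F :* (V :* W :+ I :* (U :* P) :- (con 1ℚ :+ I) :* V :* P)) refl T I F u u′ P W ⟩
      (T - I) * F * (u * P) + ((1ℚ + T) * u′ - T * u) * ((1ℚ + I) * (F * P)) + (1ℚ + T) * F * (u′ * W + I * (u * P) - (1ℚ + I) * u′ * P)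
        ≡⟨ cong₂ (λ g y → g * (u * P) + y * ((1ℚ + I) * (F * P)) + (1ℚ + T) * F * (u′ * W + I * (u * P) - (1ℚ + I) * u′ * P))
             (sym (ℕtoℚ-P′-suc t i)) (sym z≡) ⟩
      ℕtoℚ (t P′ suc i) * (u * P) + z * ((1ℚ + I) * (F * P)) + (1ℚ + T) * F * (u′ * W + I * (u * P) - (1ℚ + I) * u′ * P)
        ≡⟨ cong (λ k → ℕtoℚ (t P′ suc i) * (u * P) + z * (k * (F * P)) + (1ℚ + T) * F * (u′ * W + I * (u * P) - k * u′ * P))
             (sym (ℕtoℚ-suc i)) ⟩
      fallingPow t u (suc i) + z * ∂ (fallingPow t u) (suc i) + (1ℚ + T) * F * gap ∎
      where
      I = ℕtoℚ i
      P = u ^ i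
      W = u′ ^ i

  mass : ∀ {n} → Subset n → (Fin n → ℚ) → ℚ
  mass [] x = 0ℚ
  mass (inside ∷ T) x = x zero + mass T (tail x)
  mass (outside ∷ T) x = mass T (tail x)

  mass-nonNeg : ∀ {n} (T : Subset n) x → (∀ i → 0ℚ ≤ x i) → 0ℚ ≤ mass T x
  mass-nonNeg [] x 0≤x = ≤-refl
  mass-nonNeg (inside ∷ T) x 0≤x = nonNeg-+ (0≤x zero) (mass-nonNeg T (tail x) (0≤x ∘ suc))
  mass-nonNeg (outside ∷ T) x 0≤x = mass-nonNeg T (tail x) (0≤x ∘ suc)

  mass+mass-∁ : ∀ {n} (T : Subset n) x → mass T x + mass (∁ T) x ≡ sumFin n x
  mass+mass-∁ [] x = refl
  mass+mass-∁ (inside ∷ T) x =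
    trans (+-assoc (x zero) (mass T (tail x)) (mass (∁ T) (tail x))) (cong (x zero +_) (mass+mass-∁ T (tail x)))
  mass+mass-∁ (outside ∷ T) x =
    trans (solve 3 (λ a b c → a :+ (c :+ b) := c :+ (a :+ b)) refl (mass T (tail x)) (mass (∁ T) (tail x)) (x zero))
          (cong (x zero +_) (mass+mass-∁ T (tail x)))

  lagrangianAt-complete-suc-≤ : ∀ {n} (x : Fin (suc n) → ℚ) b m k → 0ℚ ≤ x zero →
    (∀ j → lagrangianAt (complete j) (tail x) ≤ binomialShift b j m) →
    lagrangianAt (complete (suc k)) x ≤ binomialShift b (suc k) m + ℕtoℚ (suc k) * x zero * binomialShift b k m
  lagrangianAt-complete-suc-≤ x b m k 0≤x₀ bound = begin
    lagrangianAt (complete (suc k)) x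
      ≡⟨ lagrangianAt-complete-suc k x ⟩
    lagrangianAt (complete (suc k)) (tail x) + ℕtoℚ (suc k) * x zero * lagrangianAt (complete k) (tail x)
      ≤⟨ +-mono-≤ (bound (suc k)) (*-monoˡ-≤-0≤ (nonNeg-* (ℕtoℚ-nonNeg (suc k)) 0≤x₀) (bound k)) ⟩
    binomialShift b (suc k) m + ℕtoℚ (suc k) * x zero * binomialShift b k m ∎
    where open ≤-Reasoning

  -- The vertices of T may be given their mean weight u, and the weight outside T melted into
  -- the single mass b = mass (∁ T) x, without decreasing any λ'(K^(k), x).
  record Smoothing {n} (T : Subset n) (x : Fin n → ℚ) : Set where
    field
      u : ℚ
      0≤u : 0ℚ ≤ u
      mass≡ : ℕtoℚ ∣ T ∣ * u ≡ mass T x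
      bound : ∀ k → lagrangianAt (complete k) x ≤ binomialShift (mass (∁ T) x) k (fallingPow ∣ T ∣ u)

  smoothing : ∀ {n} (T : Subset n) x → (∀ i → 0ℚ ≤ x i) → Smoothing T x
  smoothing [] x 0≤x = record { u = 0ℚ ; 0≤u = ≤-refl ; mass≡ = refl ; bound = bound }
    where
    bound : ∀ k → lagrangianAt (complete k) x ≤ binomialShift 0ℚ k (fallingPow 0 0ℚ)
    bound zero = ≤-refl
    bound (suc k) = binomialShift-nonNeg 0ℚ (suc k) ≤-refl (λ j → fallingPow-nonNeg 0 j ≤-refl)
  smoothing (outside ∷ T) x 0≤x = record { u = u ; 0≤u = 0≤u ; mass≡ = mass≡ ; bound = bound }
    where
    open Smoothing (smoothing T (tail x) (0≤x ∘ suc)) renaming (bound to tail-bound)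
    b = mass (∁ T) (tail x)
    bound : ∀ k → lagrangianAt (complete k) x ≤ binomialShift (x zero + b) k (fallingPow ∣ T ∣ u)
    bound zero = ≤-reflexive (lagrangianAt-complete-0 x)
    bound (suc k) = ≤-trans (lagrangianAt-complete-suc-≤ x b _ k (0≤x zero) tail-bound)
      (binomialShift-absorb b (x zero) k _ (mass-nonNeg (∁ T) (tail x) (0≤x ∘ suc)) (0≤x zero)
                            (λ j → fallingPow-nonNeg ∣ T ∣ j 0≤u))
  smoothing (inside ∷ T) x 0≤x = record { u = u′ ; 0≤u = 0≤u′ ; mass≡ = mass≡′ ; bound = bound }
    where
    open Smoothing (smoothing T (tail x) (0≤x ∘ suc)) renaming (bound to tail-bound)
    t = ∣ T ∣
    b = mass (∁ T) (tail x)
    instance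
      t+1≢0 : NonZero (ℕtoℚ (suc t))
      t+1≢0 = ℕtoℚ-nonZero (suc t)
    u′ = 1/ ℕtoℚ (suc t) * (ℕtoℚ t * u + x zero)
    0≤u′ : 0ℚ ≤ u′
    0≤u′ = nonNeg-* (1/ℕtoℚ-nonNeg (suc t)) (nonNeg-+ (nonNeg-* (ℕtoℚ-nonNeg t) 0≤u) (0≤x zero))
    mean : ℕtoℚ (suc t) * u′ ≡ ℕtoℚ t * u + x zero
    mean = trans (sym (*-assoc (ℕtoℚ (suc t)) (1/ ℕtoℚ (suc t)) y))
                 (trans (cong (_* y) (*-inverseʳ (ℕtoℚ (suc t)))) (*-identityˡ y))
      where y = ℕtoℚ t * u + x zero
    mass≡′ : ℕtoℚ (suc t) * u′ ≡ x zero + mass T (tail x)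
    mass≡′ = trans mean (trans (+-comm (ℕtoℚ t * u) (x zero)) (cong (x zero +_) mass≡))
    M = fallingPow t u
    bound : ∀ k → lagrangianAt (complete k) x ≤ binomialShift b k (fallingPow (suc t) u′)
    bound zero = ≤-reflexive (lagrangianAt-complete-0 x)
    bound (suc k) = begin
      lagrangianAt (complete (suc k)) x
        ≤⟨ lagrangianAt-complete-suc-≤ x b M k (0≤x zero) tail-bound ⟩
      binomialShift b (suc k) M + ℕtoℚ (suc k) * x zero * binomialShift b k M
        ≡⟨ binomialShift-+-∂ b k (x zero) M ⟨
      binomialShift b (suc k) (λ j → M j + x zero * ∂ M j)
        ≤⟨ binomialShift-mono b (suc k) (mass-nonNeg (∁ T) (tail x) (0≤x ∘ suc))
             (λ j _ → fallingPow-smooth t (x zero) j 0≤u 0≤u′ mean) ⟩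
      binomialShift b (suc k) (fallingPow (suc t) u′) ∎
      where open ≤-Reasoning

  oneEdges : ∀ {n} → Hypergraph n → Hypergraph n
  oneEdges H F = complete 1 F ∧ H F

  singletons : ∀ {n} → Hypergraph n → Subset n
  singletons H = tabulate (λ i → H ⁅ i ⁆)

  lagrangianAt-oneEdges : ∀ {n} (H : Hypergraph n) x → lagrangianAt (oneEdges H) x ≡ mass (singletons H) x
  lagrangianAt-oneEdges {zero} H x = refl
  lagrangianAt-oneEdges {suc n} H x = begin
    lagrangianAt (oneEdges H) x
      ≡⟨ lagrangianWith-∷ factorial (oneEdges H) x ⟩
    x zero * lagrangianWith (factorial ∘ suc) (λ F → complete 0 F ∧ H (inside ∷ F)) (tail x)
      + lagrangianAt (oneEdges H′) (tail x)
      ≡⟨ cong₂ (λ a b → x zero * a + b) (lagrangianWith-size-0 (factorial ∘ suc) (H ∘ (inside ∷_)) (tail x))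
                                         (lagrangianAt-oneEdges H′ (tail x)) ⟩
    x zero * (if H ⁅ zero ⁆ then 1ℚ else 0ℚ) + mass (singletons H′) (tail x)
      ≡⟨ head-mass (H ⁅ zero ⁆) ⟩
    mass (singletons H) x ∎
    where
    open ≡-Reasoning
    H′ = H ∘ (outside ∷_)
    head-mass : ∀ b → x zero * (if b then 1ℚ else 0ℚ) + mass (singletons H′) (tail x) ≡ mass (b ∷ singletons H′) x
    head-mass true = cong (_+ mass (singletons H′) (tail x)) (*-identityʳ (x zero))
    head-mass false = trans (cong (_+ mass (singletons H′) (tail x)) (*-zeroʳ (x zero))) (+-identityˡ _)

  ∣p∣≡0⇒p≡⊥ : ∀ {n} (p : Subset n) → ∣ p ∣ ≡ 0 → p ≡ ⊥
  ∣p∣≡0⇒p≡⊥ [] _ = refl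
  ∣p∣≡0⇒p≡⊥ (outside ∷ p) ∣p∣≡0 = cong (outside ∷_) (∣p∣≡0⇒p≡⊥ p ∣p∣≡0)

  singletons-complete : ∀ {n} (H : Hypergraph n) → IsCompleteSub One H (singletons H)
  singletons-complete H (inside ∷ F) F⊆S ∣F∣≡1 with refl ← ∣p∣≡0⇒p≡⊥ F (ℕ.suc-injective ∣F∣≡1) = []=⇒lookup (F⊆S here)
  singletons-complete H (outside ∷ F) F⊆S ∣F∣≡1 = singletons-complete (H ∘ (outside ∷_)) F (drop-∷-⊆ F⊆S) ∣F∣≡1

  ⊆-singletons : ∀ {n} (H : Hypergraph n) S → IsCompleteSub One H S → S ⊆ singletons H
  ⊆-singletons H S S-complete {i} i∈S =
    lookup⇒[]= i (singletons H) (trans (lookup∘tabulate (λ i → H ⁅ i ⁆) i) (S-complete ⁅ i ⁆ ⁅i⁆⊆S (∣⁅x⁆∣≡1 i)))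
    where
    ⁅i⁆⊆S : ⁅ i ⁆ ⊆ S
    ⁅i⁆⊆S j∈⁅i⁆ = subst (_∈ S) (sym (x∈⁅y⁆⇒x≡y i j∈⁅i⁆)) i∈S

  ∣singletons∣ : ∀ {n} (H : Hypergraph n) {t} → MaxCompleteOrder One H t → ∣ singletons H ∣ ≡ t
  ∣singletons∣ H ((S , ∣S∣≡t , S-complete) , maximal) = ℕ.≤-antisym (maximal (singletons H) (singletons-complete H))
    (subst (ℕ._≤ ∣ singletons H ∣) ∣S∣≡t (p⊆q⇒∣p∣≤∣q∣ (⊆-singletons H S S-complete)))

  indicator : ∀ {n} → Subset n → ℚ → Fin n → ℚ
  indicator S c i = if lookup S i then c else 0ℚ

  indicator-nonNeg : ∀ {n} (S : Subset n) {c} → 0ℚ ≤ c → ∀ i → 0ℚ ≤ indicator S c i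
  indicator-nonNeg S 0≤c i with lookup S i
  ... | true = 0≤c
  ... | false = ≤-refl

  sumFin-indicator : ∀ {n} (S : Subset n) c → sumFin n (indicator S c) ≡ ℕtoℚ ∣ S ∣ * c
  sumFin-indicator [] c = sym (*-zeroˡ c)
  sumFin-indicator (inside ∷ S) c = begin
    c + sumFin _ (indicator S c)  ≡⟨ cong (c +_) (sumFin-indicator S c) ⟩
    c + ℕtoℚ ∣ S ∣ * c            ≡⟨ solve 2 (λ c s → c :+ s :* c := (con 1ℚ :+ s) :* c) refl c (ℕtoℚ ∣ S ∣) ⟩
    (1ℚ + ℕtoℚ ∣ S ∣) * c         ≡⟨ cong (_* c) (ℕtoℚ-suc ∣ S ∣) ⟨
    ℕtoℚ (suc ∣ S ∣) * c          ∎
    where open ≡-Reasoning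
  sumFin-indicator (outside ∷ S) c = trans (+-identityˡ _) (sumFin-indicator S c)

  lagrangianWith-indicator-cong : ∀ {n} v {E E′ : Hypergraph n} S c → (∀ F → F ⊆ S → E F ≡ E′ F) →
    lagrangianWith v E (indicator S c) ≡ lagrangianWith v E′ (indicator S c)
  lagrangianWith-indicator-cong v [] c agree = cong (λ b → (if b then v 0 * 1ℚ else 0ℚ) + 0ℚ) (agree [] (λ ()))
  lagrangianWith-indicator-cong v {E} {E′} (inside ∷ S) c agree = begin
    lagrangianWith v E (indicator (inside ∷ S) c)
      ≡⟨ lagrangianWith-∷ v E _ ⟩
    c * lagrangianWith (v ∘ suc) (E ∘ (inside ∷_)) (indicator S c) + lagrangianWith v (E ∘ (outside ∷_)) (indicator S c)
      ≡⟨ cong₂ (λ a b → c * a + b)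
           (lagrangianWith-indicator-cong (v ∘ suc) S c (λ F F⊆S → agree (inside ∷ F) (s⊆s F⊆S)))
           (lagrangianWith-indicator-cong v S c (λ F F⊆S → agree (outside ∷ F) (out⊆ F⊆S))) ⟩
    c * lagrangianWith (v ∘ suc) (E′ ∘ (inside ∷_)) (indicator S c) + lagrangianWith v (E′ ∘ (outside ∷_)) (indicator S c)
      ≡⟨ lagrangianWith-∷ v E′ _ ⟨
    lagrangianWith v E′ (indicator (inside ∷ S) c) ∎
    where open ≡-Reasoning
  lagrangianWith-indicator-cong v {E} {E′} (outside ∷ S) c agree = begin
    lagrangianWith v E (indicator (outside ∷ S) c)
      ≡⟨ lagrangianWith-∷ v E _ ⟩
    0ℚ * A + lagrangianWith v (E ∘ (outside ∷_)) (indicator S c)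
      ≡⟨ cong₂ _+_ (trans (*-zeroˡ A) (sym (*-zeroˡ A′)))
           (lagrangianWith-indicator-cong v S c (λ F F⊆S → agree (outside ∷ F) (out⊆ F⊆S))) ⟩
    0ℚ * A′ + lagrangianWith v (E′ ∘ (outside ∷_)) (indicator S c)
      ≡⟨ lagrangianWith-∷ v E′ _ ⟨
    lagrangianWith v E′ (indicator (outside ∷ S) c) ∎
    where
    open ≡-Reasoning
    A = lagrangianWith (v ∘ suc) (E ∘ (inside ∷_)) (indicator S c)
    A′ = lagrangianWith (v ∘ suc) (E′ ∘ (inside ∷_)) (indicator S c)

  lagrangianAt-complete-indicator : ∀ {n} k (S : Subset n) c →
    lagrangianAt (complete k) (indicator S c) ≡ ℕtoℚ (∣ S ∣ P′ k) * c ^ k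
  lagrangianAt-complete-indicator zero S c = lagrangianAt-complete-0 (indicator S c)
  lagrangianAt-complete-indicator (suc k) [] c =
    sym (trans (cong (λ n → ℕtoℚ (n ℕ.* (0 P′ k)) * c ^ suc k) (ℕ.0∸n≡0 k)) (*-zeroˡ (c ^ suc k)))
  lagrangianAt-complete-indicator (suc k) (inside ∷ S) c = begin
    lagrangianAt (complete (suc k)) (indicator (inside ∷ S) c)
      ≡⟨ lagrangianAt-complete-suc k (indicator (inside ∷ S) c) ⟩
    lagrangianAt (complete (suc k)) (indicator S c) + ℕtoℚ (suc k) * c * lagrangianAt (complete k) (indicator S c)
      ≡⟨ cong₂ (λ a b → a + ℕtoℚ (suc k) * c * b)
           (lagrangianAt-complete-indicator (suc k) S c) (lagrangianAt-complete-indicator k S c) ⟩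
    ℕtoℚ (s P′ suc k) * c ^ suc k + ℕtoℚ (suc k) * c * (ℕtoℚ (s P′ k) * c ^ k)
      ≡⟨ solve 5 (λ A c K B P → A :* (c :* P) :+ K :* c :* (B :* P) := (A :+ K :* B) :* (c :* P)) refl
           (ℕtoℚ (s P′ suc k)) c (ℕtoℚ (suc k)) (ℕtoℚ (s P′ k)) (c ^ k) ⟩
    (ℕtoℚ (s P′ suc k) + ℕtoℚ (suc k) * ℕtoℚ (s P′ k)) * c ^ suc k
      ≡⟨ cong (_* c ^ suc k) (trans (cong (ℕtoℚ (s P′ suc k) +_) (sym (ℕtoℚ-* (suc k) (s P′ k)))) (sym (ℕtoℚ-+ (s P′ suc k) _))) ⟩
    ℕtoℚ (s P′ suc k ℕ.+ suc k ℕ.* (s P′ k)) * c ^ suc k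
      ≡⟨ cong (λ n → ℕtoℚ n * c ^ suc k) (P′-pascal s k) ⟩
    ℕtoℚ (suc s P′ suc k) * c ^ suc k ∎
    where
    open ≡-Reasoning
    s = ∣ S ∣
  lagrangianAt-complete-indicator (suc k) (outside ∷ S) c = begin
    lagrangianAt (complete (suc k)) (indicator (outside ∷ S) c)
      ≡⟨ lagrangianAt-complete-suc k (indicator (outside ∷ S) c) ⟩
    lagrangianAt (complete (suc k)) (indicator S c) + ℕtoℚ (suc k) * 0ℚ * lagrangianAt (complete k) (indicator S c)
      ≡⟨ solve 3 (λ a K b → a :+ K :* con 0ℚ :* b := a) refl _ (ℕtoℚ (suc k)) _ ⟩
    lagrangianAt (complete (suc k)) (indicator S c)
      ≡⟨ lagrangianAt-complete-indicator (suc k) S c ⟩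
    ℕtoℚ (∣ S ∣ P′ suc k) * c ^ suc k ∎
    where open ≡-Reasoning

  complete-∨-of-size : ∀ {n} j k (F : Subset n) → ∣ F ∣ ≡ j ⊎ ∣ F ∣ ≡ k → IsEdge (λ F → complete j F ∨ complete k F) F
  complete-∨-of-size j k F (inj₁ ∣F∣≡j) rewrite complete-of-size F ∣F∣≡j = refl
  complete-∨-of-size j k F (inj₂ ∣F∣≡k) rewrite complete-of-size F ∣F∣≡k = ∨-zeroʳ (complete j F)

  complete-1-disjoint : ∀ {n} m (F : Subset n) → IsEdge (complete 1) F → complete (suc (suc m)) F ≡ false
  complete-1-disjoint m F F∈K₁ rewrite complete-size F F∈K₁ = refl

  complete-subgraph-agrees : ∀ {n} r (H : Hypergraph n) S → (∀ F → IsEdge H F → ∣ F ∣ ≡ 1 ⊎ ∣ F ∣ ≡ r) →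
    IsCompleteSub (OneOr r) H S → ∀ F → F ⊆ S → H F ≡ (complete 1 F ∨ complete r F)
  complete-subgraph-agrees r H S edge-sizes S-complete F F⊆S with complete 1 F in F∈K₁ | complete r F in F∈Kʳ
  ... | true | _ = S-complete F F⊆S (inj₁ (complete-size F F∈K₁))
  ... | false | true = S-complete F F⊆S (inj₂ (complete-size F F∈Kʳ))
  ... | false | false with H F in F∈H
  ...   | false = refl
  ...   | true with edge-sizes F F∈H
  ...     | inj₁ ∣F∣≡1 with () ← trans (sym F∈K₁) (complete-of-size F ∣F∣≡1)
  ...     | inj₂ ∣F∣≡r with () ← trans (sym F∈Kʳ) (complete-of-size F ∣F∣≡r)

  K1r-edge-sizes : ∀ t r F → IsEdge (K1r t r) F → ∣ F ∣ ≡ 1 ⊎ ∣ F ∣ ≡ r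
  K1r-edge-sizes t r F F∈K with complete 1 F in F∈K₁
  ... | true = inj₁ (complete-size F F∈K₁)
  ... | false = inj₂ (complete-size F F∈K)

  K1r-maxCompleteOrder : ∀ t r (R : ℕ → Set) → (∀ k → R k → k ≡ 1 ⊎ k ≡ r) → MaxCompleteOrder R (K1r t r) t
  K1r-maxCompleteOrder t r R R⊆1r =
    (⊤ , ∣⊤∣≡n t , λ F _ R∣F∣ → complete-∨-of-size 1 r F (R⊆1r ∣ F ∣ R∣F∣)) , λ S _ → ∣p∣≤n S

  /-*-cancel : ∀ p d → .{{_ : ℕ.NonZero d}} → (ℤ.+ p) / d * ℕtoℚ d ≡ ℕtoℚ p
  /-*-cancel p (suc d) = toℚᵘ-injective (begin-equality
    toℚᵘ ((ℤ.+ p) / suc d * ℕtoℚ (suc d))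
      ≃⟨ toℚᵘ-homo-* ((ℤ.+ p) / suc d) (ℕtoℚ (suc d)) ⟩
    toℚᵘ ((ℤ.+ p) / suc d) ℚᵘ.* toℚᵘ (ℕtoℚ (suc d))
      ≃⟨ ℚᵘ.*-cong (toℚᵘ-fromℚᵘ (mkℚᵘ (ℤ.+ p) d)) (toℚᵘ-fromℚᵘ (mkℚᵘ (ℤ.+ suc d) 0)) ⟩
    mkℚᵘ (ℤ.+ p) d ℚᵘ.* mkℚᵘ (ℤ.+ suc d) 0
      ≃⟨ ℚᵘ.*≡* cross ⟩
    mkℚᵘ (ℤ.+ p) 0
      ≃⟨ toℚᵘ-fromℚᵘ (mkℚᵘ (ℤ.+ p) 0) ⟨
    toℚᵘ (ℕtoℚ p) ∎)
    where
    open ℚᵘ.≤-Reasoning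
    cross : (ℤ.+ p ℤ.* ℤ.+ suc d) ℤ.* ℤ.+ 1 ≡ ℤ.+ p ℤ.* ℤ.+ (suc d ℕ.* 1)
    cross = trans (ℤ.*-identityʳ _) (cong (λ n → ℤ.+ p ℤ.* ℤ.+ n) (sym (ℕ.*-identityʳ (suc d))))

  prodDiff≡P′ : ∀ s k → k ℕ.≤ s → prodDiff (suc s) k ≡ ℤ.+ (s P′ k)
  prodDiff≡P′ s zero _ = refl
  prodDiff≡P′ s (suc k) k<s = begin
    prodDiff (suc s) k ℤ.* (ℤ.+ suc s ℤ.- ℤ.+ suc k)
      ≡⟨ cong₂ ℤ._*_ (prodDiff≡P′ s k (ℕ.<⇒≤ k<s)) (trans (ℤ.m-n≡m⊖n (suc s) (suc k)) (ℤ.⊖-≥ (ℕ.m≤n⇒m≤1+n k<s))) ⟩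
    ℤ.+ (s P′ k) ℤ.* ℤ.+ (s ℕ.∸ k)
      ≡⟨ ℤ.pos-* (s P′ k) (s ℕ.∸ k) ⟨
    ℤ.+ ((s P′ k) ℕ.* (s ℕ.∸ k))
      ≡⟨ cong ℤ.+_ (ℕ.*-comm (s P′ k) (s ℕ.∸ k)) ⟩
    ℤ.+ (s P′ suc k) ∎
    where open ≡-Reasoning

  lagFormula-*-^ : ∀ t k → k ℕ.< t →
    lagFormula t (suc k) * ℕtoℚ t ^ suc k ≡ ℕtoℚ t ^ suc k + ℕtoℚ (t P′ suc k)
  lagFormula-*-^ (suc s) k (s≤s k≤s) = begin
    (1ℚ + prodDiff (suc s) k / suc s ℕ.^ k) * (T * T ^ k)
      ≡⟨ cong (λ z → (1ℚ + z / suc s ℕ.^ k) * (T * T ^ k)) (prodDiff≡P′ s k k≤s) ⟩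
    (1ℚ + q) * (T * T ^ k)
      ≡⟨ solve 3 (λ q T P → (con 1ℚ :+ q) :* (T :* P) := T :* P :+ (q :* P) :* T) refl q T (T ^ k) ⟩
    T ^ suc k + (q * T ^ k) * T
      ≡⟨ cong (λ z → T ^ suc k + (q * z) * T) (sym (ℕtoℚ-^ (suc s) k)) ⟩
    T ^ suc k + (q * ℕtoℚ (suc s ℕ.^ k)) * T
      ≡⟨ cong (λ z → T ^ suc k + z * T) (/-*-cancel (s P′ k) (suc s ℕ.^ k)) ⟩
    T ^ suc k + ℕtoℚ (s P′ k) * T
      ≡⟨ cong (T ^ suc k +_) (trans (*-comm (ℕtoℚ (s P′ k)) T) (sym (ℕtoℚ-* (suc s) (s P′ k)))) ⟩
    T ^ suc k + ℕtoℚ (suc s ℕ.* (s P′ k))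
      ≡⟨ cong (λ n → T ^ suc k + ℕtoℚ n) (P′-suc s k) ⟨
    T ^ suc k + ℕtoℚ (suc s P′ suc k) ∎
    where
    open ≡-Reasoning
    instance
      [1+s]^k≢0 : ℕ.NonZero (suc s ℕ.^ k)
      [1+s]^k≢0 = ℕ.m^n≢0 (suc s) k
    T = ℕtoℚ (suc s)
    q = ℤ.+ (s P′ k) / suc s ℕ.^ k

  module ThresholdBound (m t : ℕ) (threshold : Threshold (suc (suc m)) t) where

    open AboveThreshold m t threshold

    T ρ c : ℚ
    T = ℕtoℚ t
    ρ = ℕtoℚ r
    c = lagFormula t r

    c*T^r : c * T ^ r ≡ T ^ r + ℕtoℚ (t P′ r)
    c*T^r = lagFormula-*-^ t (suc m) r≤t

    instance
      T≢0 : NonZero T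
      T≢0 = ℕtoℚ-nonZero t

    c-uniform : T * (1/ T) + ℕtoℚ (t P′ r) * (1/ T) ^ r ≡ c
    c-uniform = begin
      T * τ + F * τ ^ r               ≡⟨ cong (_+ F * τ ^ r) (trans (*-inverseʳ T) (sym T^r*τ^r≡1)) ⟩
      T ^ r * τ ^ r + F * τ ^ r       ≡⟨ *-distribʳ-+ (τ ^ r) (T ^ r) F ⟨
      (T ^ r + F) * τ ^ r             ≡⟨ cong (_* τ ^ r) c*T^r ⟨
      c * T ^ r * τ ^ r               ≡⟨ *-assoc c (T ^ r) (τ ^ r) ⟩
      c * (T ^ r * τ ^ r)             ≡⟨ trans (cong (c *_) T^r*τ^r≡1) (*-identityʳ c) ⟩
      c                               ∎
      where
      open ≡-Reasoning
      τ = 1/ T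
      F = ℕtoℚ (t P′ r)
      T^r*τ^r≡1 : T ^ r * τ ^ r ≡ 1ℚ
      T^r*τ^r≡1 = trans (sym (^-distrib-* T τ r)) (trans (cong (_^ r) (*-inverseʳ T)) (1^n≡1 r))

    ℕtoℚ-φ : ∀ j → ℕtoℚ (φ j) ≡ ρ * ℕtoℚ (t P′ j) + ℕtoℚ j * T ^ j
    ℕtoℚ-φ j = trans (ℕtoℚ-+ (r ℕ.* (t P′ j)) (j ℕ.* t ℕ.^ j))
      (cong₂ _+_ (ℕtoℚ-* r (t P′ j)) (trans (ℕtoℚ-* j (t ℕ.^ j)) (cong (ℕtoℚ j *_) (ℕtoℚ-^ t j))))

    -- t P′ j / t ^ j ≤ c − j / r, with the denominators cleared.
    P′-bound : ∀ j → j ℕ.≤ r → ρ * ℕtoℚ (t P′ j) + ℕtoℚ j * T ^ j ≤ ρ * c * T ^ j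
    P′-bound j j≤r = *-cancelʳ-≤-pos (T ^ r) {{T^r>0}} (begin
      (ρ * ℕtoℚ (t P′ j) + ℕtoℚ j * T ^ j) * T ^ r
        ≡⟨ cong₂ _*_ (sym (ℕtoℚ-φ j)) (sym (ℕtoℚ-^ t r)) ⟩
      ℕtoℚ (φ j) * ℕtoℚ (t ℕ.^ r)
        ≡⟨ ℕtoℚ-* (φ j) (t ℕ.^ r) ⟨
      ℕtoℚ (φ j ℕ.* t ℕ.^ r)
        ≤⟨ ℕtoℚ-mono-≤ (φ-ratio j j≤r) ⟩
      ℕtoℚ (t ℕ.^ j ℕ.* φ r)
        ≡⟨ trans (ℕtoℚ-* (t ℕ.^ j) (φ r)) (cong₂ _*_ (ℕtoℚ-^ t j) (ℕtoℚ-φ r)) ⟩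
      T ^ j * (ρ * ℕtoℚ (t P′ r) + ρ * T ^ r)
        ≡⟨ solve 4 (λ P ρ F Q → P :* (ρ :* F :+ ρ :* Q) := ρ :* P :* (Q :+ F)) refl (T ^ j) ρ (ℕtoℚ (t P′ r)) (T ^ r) ⟩
      ρ * T ^ j * (T ^ r + ℕtoℚ (t P′ r))
        ≡⟨ cong (ρ * T ^ j *_) (sym c*T^r) ⟩
      ρ * T ^ j * (c * T ^ r)
        ≡⟨ solve 4 (λ ρ P c Q → ρ :* P :* (c :* Q) := ρ :* c :* P :* Q) refl ρ (T ^ j) c (T ^ r) ⟩
      ρ * c * T ^ j * T ^ r ∎)
      where
      open ≤-Reasoning
      T^r>0 : Positive (T ^ r)
      T^r>0 = subst Positive (ℕtoℚ-^ t r) (ℕtoℚ-pos (t ℕ.^ r) {{ℕ.m^n≢0 t r}})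

    shifted-bound : ∀ {u b} → 0ℚ ≤ u → 0ℚ ≤ b → T * u + b ≡ 1ℚ → T * u + binomialShift b r (fallingPow t u) ≤ c
    shifted-bound {u} {b} 0≤u 0≤b a+b≡1 = *-cancelˡ-≤-pos ρ {{ℕtoℚ-pos r}} (begin
      ρ * (a + binomialShift b r M)
        ≡⟨ *-distribˡ-+ ρ a (binomialShift b r M) ⟩
      ρ * a + ρ * binomialShift b r M
        ≡⟨ cong₂ _+_ (sym (binomialShift-mean b r a a+b≡1)) (sym (binomialShift-* b r ρ M)) ⟩
      binomialShift b r (λ j → ℕtoℚ j * a ^ j) + binomialShift b r (λ j → ρ * M j)
        ≡⟨ binomialShift-+ b r _ _ ⟨
      binomialShift b r (λ j → ℕtoℚ j * a ^ j + ρ * M j)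
        ≤⟨ binomialShift-mono b r 0≤b pointwise ⟩
      binomialShift b r (λ j → ρ * c * a ^ j)
        ≡⟨ binomialShift-* b r (ρ * c) (a ^_) ⟩
      ρ * c * binomialShift b r (a ^_)
        ≡⟨ cong (ρ * c *_) (trans (binomialShift-^ b r a) (trans (cong (_^ r) a+b≡1) (1^n≡1 r))) ⟩
      ρ * c * 1ℚ
        ≡⟨ *-identityʳ (ρ * c) ⟩
      ρ * c ∎)
      where
      open ≤-Reasoning
      a = T * u
      M = fallingPow t u
      pointwise : ∀ j → j ℕ.≤ r → ℕtoℚ j * a ^ j + ρ * M j ≤ ρ * c * a ^ j
      pointwise j j≤r = begin
        ℕtoℚ j * a ^ j + ρ * (ℕtoℚ (t P′ j) * u ^ j)
          ≡⟨ cong (λ p → ℕtoℚ j * p + ρ * (ℕtoℚ (t P′ j) * u ^ j)) (^-distrib-* T u j) ⟩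
        ℕtoℚ j * (T ^ j * u ^ j) + ρ * (ℕtoℚ (t P′ j) * u ^ j)
          ≡⟨ solve 5 (λ J P U ρ F → J :* (P :* U) :+ ρ :* (F :* U) := (ρ :* F :+ J :* P) :* U) refl
               (ℕtoℚ j) (T ^ j) (u ^ j) ρ (ℕtoℚ (t P′ j)) ⟩
        (ρ * ℕtoℚ (t P′ j) + ℕtoℚ j * T ^ j) * u ^ j
          ≤⟨ *-monoʳ-≤-0≤ (nonNeg-^ j 0≤u) (P′-bound j j≤r) ⟩
        ρ * c * T ^ j * u ^ j
          ≡⟨ trans (*-assoc (ρ * c) (T ^ j) (u ^ j)) (cong (ρ * c *_) (sym (^-distrib-* T u j))) ⟩
        ρ * c * a ^ j ∎

  module _ (m t : ℕ) (threshold : Threshold (suc (suc m)) t) where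

    open AboveThreshold m t threshold using (r; t≢0)
    open ThresholdBound m t threshold using (T; T≢0; c; c-uniform; shifted-bound)

    lagrangian-upper : ∀ {n} (H : Hypergraph n) → (∀ F → IsEdge H F → ∣ F ∣ ≡ 1 ⊎ ∣ F ∣ ≡ r) →
      MaxCompleteOrder One H t → ∀ x → InSimplex n x → lagrangianAt H x ≤ c
    lagrangian-upper {n} H edge-sizes one-order x (0≤x , Σx≡1) = begin
      lagrangianAt H x
        ≤⟨ lagrangianWith-mono factorial x (λ k → ℕtoℚ-nonNeg (k !)) 0≤x H⊆H₁∪Kʳ ⟩
      lagrangianAt (λ F → oneEdges H F ∨ complete r F) x
        ≡⟨ lagrangianWith-∨ factorial (oneEdges H) (complete r) x H₁∩Kʳ≡∅ ⟩
      lagrangianAt (oneEdges H) x + lagrangianAt (complete r) x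
        ≤⟨ +-mono-≤ (≤-reflexive (lagrangianAt-oneEdges H x)) (bound r) ⟩
      mass S x + binomialShift b r (fallingPow ∣ S ∣ u)
        ≡⟨ cong₂ (λ a s → a + binomialShift b r (fallingPow s u)) (sym T*u≡mass) ∣S∣≡t ⟩
      T * u + binomialShift b r (fallingPow t u)
        ≤⟨ shifted-bound 0≤u (mass-nonNeg (∁ S) x 0≤x) T*u+b≡1 ⟩
      c ∎
      where
      open ≤-Reasoning
      S = singletons H
      b = mass (∁ S) x
      open Smoothing (smoothing S x 0≤x)
      ∣S∣≡t = ∣singletons∣ H one-order
      T*u≡mass : T * u ≡ mass S x
      T*u≡mass = subst (λ s → ℕtoℚ s * u ≡ mass S x) ∣S∣≡t mass≡
      T*u+b≡1 : T * u + b ≡ 1ℚ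
      T*u+b≡1 = trans (cong (_+ b) T*u≡mass) (trans (mass+mass-∁ S x) Σx≡1)
      H⊆H₁∪Kʳ : ∀ F → IsEdge H F → IsEdge (λ F → oneEdges H F ∨ complete r F) F
      H⊆H₁∪Kʳ F F∈H with edge-sizes F F∈H
      ... | inj₁ ∣F∣≡1 rewrite complete-of-size F ∣F∣≡1 | F∈H = refl
      ... | inj₂ ∣F∣≡r rewrite complete-of-size F ∣F∣≡r = ∨-zeroʳ (oneEdges H F)
      H₁∩Kʳ≡∅ : ∀ F → IsEdge (oneEdges H) F → complete r F ≡ false
      H₁∩Kʳ≡∅ F F∈H₁ with complete 1 F in F∈K₁
      ... | true = complete-1-disjoint m F F∈K₁

    lagrangian-attained : ∀ {n} (H : Hypergraph n) → (∀ F → IsEdge H F → ∣ F ∣ ≡ 1 ⊎ ∣ F ∣ ≡ r) →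
      MaxCompleteOrder (OneOr r) H t → ∃ λ x → InSimplex n x × lagrangianAt H x ≡ c
    lagrangian-attained {n} H edge-sizes ((S , ∣S∣≡t , S-complete) , _) =
      indicator S τ , (indicator-nonNeg S (1/ℕtoℚ-nonNeg t) , Σx≡1) , value
      where
      τ = 1/ T
      Σx≡1 : sumFin n (indicator S τ) ≡ 1ℚ
      Σx≡1 = trans (sumFin-indicator S τ) (trans (cong (λ s → ℕtoℚ s * τ) ∣S∣≡t) (*-inverseʳ T))
      value : lagrangianAt H (indicator S τ) ≡ c
      value = begin
        lagrangianAt H (indicator S τ)
          ≡⟨ lagrangianWith-indicator-cong factorial S τ (complete-subgraph-agrees r H S edge-sizes S-complete) ⟩
        lagrangianAt (λ F → complete 1 F ∨ complete r F) (indicator S τ)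
          ≡⟨ lagrangianWith-∨ factorial (complete 1) (complete r) (indicator S τ) (complete-1-disjoint m) ⟩
        lagrangianAt (complete 1) (indicator S τ) + lagrangianAt (complete r) (indicator S τ)
          ≡⟨ cong₂ _+_ (lagrangianAt-complete-indicator 1 S τ) (lagrangianAt-complete-indicator r S τ) ⟩
        ℕtoℚ (∣ S ∣ P′ 1) * (τ * 1ℚ) + ℕtoℚ (∣ S ∣ P′ r) * τ ^ r
          ≡⟨ cong (λ s → ℕtoℚ (s P′ 1) * (τ * 1ℚ) + ℕtoℚ (s P′ r) * τ ^ r) ∣S∣≡t ⟩
        ℕtoℚ (t ℕ.* 1) * (τ * 1ℚ) + ℕtoℚ (t P′ r) * τ ^ r
          ≡⟨ cong₂ (λ s y → ℕtoℚ s * y + ℕtoℚ (t P′ r) * τ ^ r) (ℕ.*-identityʳ t) (*-identityʳ τ) ⟩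
        T * τ + ℕtoℚ (t P′ r) * τ ^ r
          ≡⟨ c-uniform ⟩
        c ∎
        where open ≡-Reasoning

    lagrangianIs : ∀ {n} (H : Hypergraph n) → (∀ F → IsEdge H F → ∣ F ∣ ≡ 1 ⊎ ∣ F ∣ ≡ r) →
      MaxCompleteOrder (OneOr r) H t → MaxCompleteOrder One H t → LagrangianIs H c
    lagrangianIs H edge-sizes one-r-order one-order =
      lagrangian-upper H edge-sizes one-order , lagrangian-attained H edge-sizes one-r-order

open Lagrangian using (lagrangianIs; K1r-edge-sizes; K1r-maxCompleteOrder)
open import Data.Nat using (ℕ; _≤_; _*_; _^_; _∸_; suc; s≤s; z≤n)
open import Data.Fin.Subset using (∣_∣)
open import Data.Product using (_×_; _,_)
open import Data.Sum using (_⊎_; inj₁)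
open import Function using (id)
open import Relation.Binary.PropositionalEquality using (_≡_)

theorem1p4 : (r n t : ℕ) → 2 ≤ r → (H : Hypergraph n) →
    (∀ F → IsEdge H F → ∣ F ∣ ≡ 1 ⊎ ∣ F ∣ ≡ r) →
    MaxCompleteOrder (OneOr r) H t →
    MaxCompleteOrder One H t →
    (r * (r ∸ 1) ∸ 1) ^ (r ∸ 2) * (r * (r ∸ 1)) ≤ t * (r * (r ∸ 1)) ^ (r ∸ 2) →
    LagrangianIs H (lagFormula t r) × LagrangianIs (K1r t r) (lagFormula t r)
theorem1p4 r@(suc (suc m)) n t (s≤s (s≤s z≤n)) H edge-sizes one-r-order one-order threshold =
  lagrangianIs m t threshold H edge-sizes one-r-order one-order ,
  lagrangianIs m t threshold (K1r t r) (K1r-edge-sizes t r)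
    (K1r-maxCompleteOrder t r (OneOr r) (λ _ → id)) (K1r-maxCompleteOrder t r One (λ _ → inj₁))
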